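{- Let $F=(V,E)$ be a connected digraph which is either a digraph-function or the inverse of a digraph-function, with $n$ vertices, and let $k$ be the number of vertices of the unique directed cycle of $F$. Then (a1) $A(\lambda , F^{00+}) = A(\lambda ^2, F) = \lambda ^{2(n - k)} (\lambda ^{2k} - 1)$; (a2) $A(\lambda , F^{0++}) = A(\lambda , F^{+0+}) = (\lambda +1)^n A\!\left(\frac{\lambda ^2}{\lambda +1},F\right) = \lambda ^{2(n-k)}[\lambda ^{2k} - (\lambda +1)^k]$; (a3) $A(\lambda , F^{+++}) = A(x_1, F)\, A(x_2, F) = \lambda^{2n - 2k} (x_1^k - 1) (x_2^k - 1)$, where $x_1 = \frac{1}{2}(2\lambda +1 + \sqrt{4\lambda +1})$ and $x_2 = \frac{1}{2}(2\lambda +1 - \sqrt{4\lambda +1})$.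
   Context: A digraph is $F=(V,E)$ with $V$ finite nonempty and $E\subseteq V\times V$ (loops allowed, no multiple arcs); for $e=(u,v)$, $t(e)=u$, $h(e)=v$. $F$ is connected if its underlying undirected graph is connected. $F$ is a digraph-function if there is $f:V\to V$ with $(x,y)\in E$ iff $y=f(x)$; the inverse is $(V,\{(y,x):(x,y)\in E\})$. A connected digraph-function or its inverse contains exactly one directed cycle (possibly a loop). $A(\lambda,G)=\det(\lambda I-A(G))$ with $A(G)$ the 0/1 adjacency matrix. The line digraph $F^l$ has vertex set $E$ and arcs $(p,q)$ with $h(p)=t(q)$. Let $W$ be the set of arcs $(v,e)$ with $v=t(e)$ and $(e,v)$ with $v=h(e)$ ($v\in V$, $e\in E$). On vertex set $V\cup E$: $F^{00+}$ has arc set $W$; $F^{+0+}$ has the arcs of $F$ plus $W$; $F^{0++}$ has the arcs of $F^l$ plus $W$; $F^{+++}$ has the arcs of $F$, of $F^l$, and $W$. -}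

module Defs where

open import Level using (Level)
open import Data.Nat using (ℕ; zero; suc) renaming (_+_ to _+ℕ_)
open import Data.Fin using (Fin; zero; suc; toℕ; punchIn; splitAt; _≟_)
open import Data.Bool using (Bool; true; false; if_then_else_; _∧_; _∨_)
open import Data.Sum using (_⊎_; inj₁; inj₂)
open import Data.Product using (Σ; ∃; _×_; _,_)
open import Relation.Nullary.Decidable using (⌊_⌋)
open import Relation.Binary.PropositionalEquality using (_≡_)
open import Function using (_∘_; _⇔_; Injective)
open import Algebra.Bundles using (CommutativeRing)

-- General digraphs: vertex set Fin n, arc set E ⊆ V × V given as a
-- Boolean (decidable) relation.  Loops allowed, no multiple arcs.

record Digraph : Set where
  field
    size : ℕ
    adj  : Fin size → Fin size → Bool
open Digraph public

-- The digraph F = (V,E) of the theorem, with its arc set E enumerated: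
-- V = Fin n, E = Fin m, tail/head maps, and (tail,head) injective
-- (E ⊆ V × V, i.e. no multiple arcs).

record ArcDigraph : Set where
  field
    n    : ℕ
    m    : ℕ
    tl   : Fin m → Fin n
    hd   : Fin m → Fin n
    noMulti : ∀ e e′ → tl e ≡ tl e′ → hd e ≡ hd e′ → e ≡ e′
open ArcDigraph public

IsArc : (F : ArcDigraph) → Fin (n F) → Fin (n F) → Set
IsArc F x y = ∃ λ e → tl F e ≡ x × hd F e ≡ y

anyFin : ∀ {k} → (Fin k → Bool) → Bool
anyFin {zero}  p = false
anyFin {suc k} p = p zero ∨ anyFin (p ∘ suc)

_==_ : ∀ {k} → Fin k → Fin k → Bool
i == j = ⌊ i ≟ j ⌋

arc? : (F : ArcDigraph) → Fin (n F) → Fin (n F) → Bool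
arc? F x y = anyFin (λ e → (tl F e == x) ∧ (hd F e == y))

underlying : ArcDigraph → Digraph
underlying F = record { size = n F ; adj = arc? F }

data UWalk (F : ArcDigraph) : Fin (n F) → Fin (n F) → Set where
  here : ∀ {x} → UWalk F x x
  fwd  : ∀ {x y z} → IsArc F x y → UWalk F y z → UWalk F x z
  bwd  : ∀ {x y z} → IsArc F y x → UWalk F y z → UWalk F x z

Connected : ArcDigraph → Set
Connected F = ∀ x y → UWalk F x y

IsDigraphFunction : ArcDigraph → Set
IsDigraphFunction F =
  Σ (Fin (n F) → Fin (n F)) λ f → ∀ x y → IsArc F x y ⇔ (y ≡ f x)

IsInverseDigraphFunction : ArcDigraph → Set
IsInverseDigraphFunction F =
  Σ (Fin (n F) → Fin (n F)) λ f → ∀ x y → IsArc F x y ⇔ (x ≡ f y)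

-- F has a directed cycle with exactly k (distinct) vertices
-- c 0 → c 1 → … → c (k-1) → c 0   (k = 1: a loop)
HasDirectedCycle : ArcDigraph → ℕ → Set
HasDirectedCycle F k =
  Σ (Fin k → Fin (n F)) λ c →
    Injective _≡_ _≡_ c ×
    (∀ (i j : Fin k) →
       (toℕ j ≡ suc (toℕ i) ⊎ (toℕ j ≡ 0 × suc (toℕ i) ≡ k)) →
       IsArc F (c i) (c j))
  × (0 Data.Nat.< k)

-- Constructions on vertex set V ∪ E = Fin (n + m):
-- vertex v ↦ v ↑ˡ m, arc e ↦ n ↑ʳ e  (split via splitAt).
-- Flags: useF = include the arcs of F, useL = include the arcs of F^l.
-- W is always included.

total : (useF useL : Bool) → ArcDigraph → Digraph
total useF useL F = record { size = n F +ℕ m F ; adj = a }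
  where
  a : Fin (n F +ℕ m F) → Fin (n F +ℕ m F) → Bool
  a i j with splitAt (n F) i | splitAt (n F) j
  ... | inj₁ x | inj₁ y = useF ∧ arc? F x y
  ... | inj₁ v | inj₂ e = tl F e == v
  ... | inj₂ e | inj₁ v = hd F e == v
  ... | inj₂ p | inj₂ q = useL ∧ (hd F p == tl F q)

F00+ F+0+ F0++ F+++ : ArcDigraph → Digraph
F00+ = total false false
F+0+ = total true  false
F0++ = total false true
F+++ = total true  true

-- Determinant (Laplace expansion along the first row) and the
-- characteristic polynomial A(t,G) = det (t I - A(G)), evaluated at an
-- element t of an arbitrary commutative ring.

module _ {c ℓ : Level} (R : CommutativeRing c ℓ) where
  open CommutativeRing R using (Carrier; _+_; _*_; -_; _-_; 0#; 1#)

  sumF : ∀ {k} → (Fin k → Carrier) → Carrier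
  sumF {zero}  f = 0#
  sumF {suc k} f = f zero + sumF (f ∘ suc)

  sgn : ℕ → Carrier
  sgn zero    = 1#
  sgn (suc j) = - sgn j

  det : ∀ {k} → (Fin k → Fin k → Carrier) → Carrier
  det {zero}  M = 1#
  det {suc k} M =
    sumF (λ j → sgn (toℕ j) * M zero j * det (λ a b → M (suc a) (punchIn j b)))

  pow : Carrier → ℕ → Carrier
  pow x zero    = 1#
  pow x (suc k) = x * pow x k

  bool01 : Bool → Carrier
  bool01 true  = 1#
  bool01 false = 0#

  adjMat : (G : Digraph) → Fin (size G) → Fin (size G) → Carrier
  adjMat G i j = bool01 (adj G i j)

  charPoly : Digraph → Carrier → Carrier
  charPoly G t = det (λ i j → (if i == j then t else 0#) - adjMat G i j)

module Submission where

-- Reversing every arc transposes all the adjacency matrices involved, so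
-- the inverse case reduces to the function case.  For a digraph-function
-- with map f and P the adjacency matrix of F, numbering each arc by its
-- tail makes V ∪ E two copies of V, and t I − A of a derived digraph
-- becomes the block matrix [[t I − u_F P, −I], [−P, t I − u_L P]], where
-- u_F, u_L ∈ {0, 1} record whether the arcs of F and of F^l are present.
-- By the Schur complement formula its determinant is that of
-- t² I − (t u_F + u_L t + 1) P + u_L u_F P², which is t² I − β P unless
-- u_F = u_L = 1, when it factors as (x₂ I − P)(x₁ I − P).  Everything thus
-- reduces to det (α I − β P) = α^(n−k) (α^k − β^k), proved by deleting
-- the leaves of the functional graph of f one at a time and expanding
-- the determinant of the bare cycle.

open import Level using (Level; _⊔_)
open import Algebra.Bundles using (CommutativeRing)
import Algebra.Solver.Ring.AlmostCommutativeRing as ACR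
open import Data.Nat as ℕ using (ℕ; zero; suc; s≤s; _≡ᵇ_)
import Data.Nat.Properties as ℕP
open import Data.Nat.GeneralisedArithmetic using (iterate)
open import Data.Integer as ℤ using (ℤ)
import Data.Integer.Properties as ℤP
open import Data.Sign as Sign using (Sign)
open import Data.Maybe using (Maybe; just; nothing)
open import Data.Fin as Fin using (Fin; zero; suc; toℕ; punchIn; punchOut; opposite; _↑ˡ_; _↑ʳ_; splitAt)
import Data.Fin.Properties as FP
open import Data.Fin.Permutation as Perm using (Permutation′; _⟨$⟩ʳ_; _⟨$⟩ˡ_)
open import Data.Bool as Bool using (Bool; true; false; if_then_else_; _∧_; _∨_; not)
import Data.Bool.Properties as BP
open import Data.Sum using (_⊎_; inj₁; inj₂)
import Data.Sum as Sum
open import Data.Product using (∃; _×_; _,_; proj₁; proj₂)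
open import Data.Empty using (⊥-elim)
open import Relation.Nullary using (yes; no; does)
open import Relation.Nullary.Decidable using (dec-true; dec-false)
open import Relation.Binary.Definitions using (tri<; tri≈; tri>)
import Relation.Binary.PropositionalEquality as ≡
open ≡ using (_≡_; _≢_)
open import Function using (_∘_; _⇔_; Equivalence; mk⇔)
open import Function.Definitions using (Injective)
open import Defs

-- A ring solver for an arbitrary commutative ring, with integer
-- coefficients: the integers map into every ring via n ↦ n ⨯ 1#.

module IntegerSolver {c ℓ : Level} (R : CommutativeRing c ℓ) where
  open CommutativeRing R
  open import Algebra.Properties.Semiring.Mult.TCOptimised semiring
    renaming (_×_ to _⨯_)
  open import Algebra.Properties.Ring ring
  open import Relation.Binary.Reasoning.Setoid setoid

  ⟦_⟧ℤ : ℤ → Carrier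
  ⟦ ℤ.+ n ⟧ℤ      = n ⨯ 1#
  ⟦ ℤ.-[1+ n ] ⟧ℤ = - (suc n ⨯ 1#)

  private
    x-0≈x : ∀ x → x - 0# ≈ x
    x-0≈x x = trans (+-congˡ -0#≈0#) (+-identityʳ x)

    -1+ : ∀ a b → a - b ≈ (1# + a) - (1# + b)
    -1+ a b = begin
      a - b                   ≈⟨ sym (+-identityˡ _) ⟩
      0# + (a - b)            ≈⟨ +-congʳ (sym (-‿inverseʳ 1#)) ⟩
      (1# - 1#) + (a - b)     ≈⟨ +-assoc 1# (- 1#) (a - b) ⟩
      1# + (- 1# + (a - b))   ≈⟨ +-congˡ (sym (+-assoc (- 1#) a (- b))) ⟩
      1# + ((- 1# + a) - b)   ≈⟨ +-congˡ (+-congʳ (+-comm (- 1#) a)) ⟩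
      1# + ((a - 1#) - b)     ≈⟨ +-congˡ (+-assoc a (- 1#) (- b)) ⟩
      1# + (a + (- 1# - b))   ≈⟨ sym (+-assoc 1# a _) ⟩
      (1# + a) + (- 1# - b)   ≈⟨ +-congˡ (-‿+-comm 1# b) ⟩
      (1# + a) - (1# + b)     ∎

    ⊖-homo : ∀ m n → ⟦ m ℤ.⊖ n ⟧ℤ ≈ m ⨯ 1# - n ⨯ 1#
    ⊖-homo zero    zero    = sym (x-0≈x 0#)
    ⊖-homo zero    (suc n) = sym (+-identityˡ _)
    ⊖-homo (suc m) zero    = sym (x-0≈x _)
    ⊖-homo (suc m) (suc n) = begin
      ⟦ suc m ℤ.⊖ suc n ⟧ℤ              ≡⟨ ≡.cong ⟦_⟧ℤ (ℤP.[1+m]⊖[1+n]≡m⊖n m n) ⟩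
      ⟦ m ℤ.⊖ n ⟧ℤ                      ≈⟨ ⊖-homo m n ⟩
      m ⨯ 1# - n ⨯ 1#                 ≈⟨ -1+ (m ⨯ 1#) (n ⨯ 1#) ⟩
      (1# + m ⨯ 1#) - (1# + n ⨯ 1#)   ≈⟨ +-cong (sym (1+× m 1#)) (-‿cong (sym (1+× n 1#))) ⟩
      suc m ⨯ 1# - suc n ⨯ 1#         ∎

    +-homo : ∀ i j → ⟦ i ℤ.+ j ⟧ℤ ≈ ⟦ i ⟧ℤ + ⟦ j ⟧ℤ
    +-homo (ℤ.+ m)    (ℤ.+ n)    = ×-homo-+ 1# m n
    +-homo (ℤ.+ m)    ℤ.-[1+ n ] = ⊖-homo m (suc n)
    +-homo ℤ.-[1+ m ] (ℤ.+ n)    = trans (⊖-homo n (suc m)) (+-comm _ _)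
    +-homo ℤ.-[1+ m ] ℤ.-[1+ n ] = begin
      - (suc (suc (m ℕ.+ n)) ⨯ 1#)    ≡⟨ ≡.cong (λ k → - (suc k ⨯ 1#)) (ℕP.+-suc m n) ⟨
      - ((suc m ℕ.+ suc n) ⨯ 1#)      ≈⟨ -‿cong (×-homo-+ 1# (suc m) (suc n)) ⟩
      - (suc m ⨯ 1# + suc n ⨯ 1#)     ≈⟨ sym (-‿+-comm _ _) ⟩
      - (suc m ⨯ 1#) + - (suc n ⨯ 1#) ∎

    signed : Sign → Carrier → Carrier
    signed Sign.+ x = x
    signed Sign.- x = - x

    signed-cong : ∀ s {x y} → x ≈ y → signed s x ≈ signed s y
    signed-cong Sign.+ e = e
    signed-cong Sign.- e = -‿cong e

    signed-* : ∀ s t x y → signed (s Sign.* t) (x * y) ≈ signed s x * signed t y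
    signed-* Sign.+ Sign.+ x y = refl
    signed-* Sign.+ Sign.- x y = -‿distribʳ-* x y
    signed-* Sign.- Sign.+ x y = -‿distribˡ-* x y
    signed-* Sign.- Sign.- x y = begin
      x * y         ≈⟨ sym (-‿involutive _) ⟩
      - (- (x * y)) ≈⟨ -‿cong (-‿distribˡ-* x y) ⟩
      - (- x * y)   ≈⟨ -‿distribʳ-* (- x) y ⟩
      - x * - y     ∎

    ◃-homo : ∀ s n → ⟦ s ℤ.◃ n ⟧ℤ ≈ signed s (n ⨯ 1#)
    ◃-homo Sign.+ zero    = refl
    ◃-homo Sign.- zero    = sym -0#≈0#
    ◃-homo Sign.+ (suc n) = refl
    ◃-homo Sign.- (suc n) = refl

    sign-abs : ∀ i → ⟦ i ⟧ℤ ≈ signed (ℤ.sign i) (ℤ.∣ i ∣ ⨯ 1#)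
    sign-abs (ℤ.+ n)    = refl
    sign-abs ℤ.-[1+ n ] = refl

    *-homo : ∀ i j → ⟦ i ℤ.* j ⟧ℤ ≈ ⟦ i ⟧ℤ * ⟦ j ⟧ℤ
    *-homo i j = begin
      ⟦ i ℤ.* j ⟧ℤ
        ≈⟨ ◃-homo (ℤ.sign i Sign.* ℤ.sign j) (ℤ.∣ i ∣ ℕ.* ℤ.∣ j ∣) ⟩
      signed (ℤ.sign i Sign.* ℤ.sign j) ((ℤ.∣ i ∣ ℕ.* ℤ.∣ j ∣) ⨯ 1#)
        ≈⟨ signed-cong (ℤ.sign i Sign.* ℤ.sign j) (×1-homo-* ℤ.∣ i ∣ ℤ.∣ j ∣) ⟩
      signed (ℤ.sign i Sign.* ℤ.sign j) ((ℤ.∣ i ∣ ⨯ 1#) * (ℤ.∣ j ∣ ⨯ 1#))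
        ≈⟨ signed-* (ℤ.sign i) (ℤ.sign j) _ _ ⟩
      signed (ℤ.sign i) (ℤ.∣ i ∣ ⨯ 1#) * signed (ℤ.sign j) (ℤ.∣ j ∣ ⨯ 1#)
        ≈⟨ *-cong (sym (sign-abs i)) (sym (sign-abs j)) ⟩
      ⟦ i ⟧ℤ * ⟦ j ⟧ℤ ∎

    neg-homo : ∀ i → ⟦ ℤ.- i ⟧ℤ ≈ - ⟦ i ⟧ℤ
    neg-homo (ℤ.+ zero)  = sym -0#≈0#
    neg-homo (ℤ.+ suc n) = refl
    neg-homo ℤ.-[1+ n ]  = sym (-‿involutive _)

    ℤ⟶R : ℤ.+-*-rawRing ACR.-Raw-AlmostCommutative⟶ ACR.fromCommutativeRing R
    ℤ⟶R = record
      { ⟦_⟧ = ⟦_⟧ℤ ; +-homo = +-homo ; *-homo = *-homo ; -‿homo = neg-homo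
      ; 0-homo = refl ; 1-homo = refl }

    -- the solver only needs to recognise syntactically equal coefficients
    coeff-≟ : ∀ a b → Maybe (⟦ a ⟧ℤ ≈ ⟦ b ⟧ℤ)
    coeff-≟ a b with a ℤ.≟ b
    ... | yes ≡.refl = just refl
    ... | no _     = nothing

  open import Algebra.Solver.Ring ℤ.+-*-rawRing (ACR.fromCommutativeRing R) ℤ⟶R coeff-≟ public

  :0 :1 : ∀ {n} → Polynomial n
  :0 = con (ℤ.+ 0)
  :1 = con (ℤ.+ 1)

module _ where
  open ≡

  ==-refl : ∀ {k} (i : Fin k) → (i == i) ≡ true
  ==-refl i with i Fin.≟ i
  ... | yes _  = refl
  ... | no i≢i = ⊥-elim (i≢i refl)

  ==-≢ : ∀ {k} {i j : Fin k} → i ≢ j → (i == j) ≡ false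
  ==-≢ {i = i} {j} i≢j with i Fin.≟ j
  ... | yes i≡j = ⊥-elim (i≢j i≡j)
  ... | no _    = refl

  ==-sym : ∀ {k} (i j : Fin k) → (i == j) ≡ (j == i)
  ==-sym i j with i Fin.≟ j
  ... | yes refl = sym (==-refl i)
  ... | no i≢j   = sym (==-≢ (i≢j ∘ sym))

  ==-injective : ∀ {k l} (κ : Fin k → Fin l) → Injective _≡_ _≡_ κ →
    ∀ a b → (κ a == κ b) ≡ (a == b)
  ==-injective κ inj a b with a Fin.≟ b
  ... | yes refl = ==-refl (κ a)
  ... | no a≢b   = ==-≢ (a≢b ∘ inj)

module CyclicOrder where
  open ≡

  Follows : ∀ {k} → Fin k → Fin k → Set
  Follows {k} i j = toℕ j ≡ suc (toℕ i) ⊎ (toℕ j ≡ 0 × suc (toℕ i) ≡ k)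

  next : ∀ {k} → Fin k → Fin k
  next {suc m} i with suc (toℕ i) ℕ.<? suc m
  ... | yes i+1<k = Fin.fromℕ< i+1<k
  ... | no _      = zero

  prev : ∀ {k} → Fin k → Fin k
  prev {suc m} zero    = Fin.fromℕ m
  prev {suc m} (suc i) = Fin.inject₁ i

  next-follows : ∀ {k} (i : Fin k) → Follows i (next i)
  next-follows {suc m} i with suc (toℕ i) ℕ.<? suc m
  ... | yes i+1<k = inj₁ (FP.toℕ-fromℕ< i+1<k)
  ... | no i+1≮k  = inj₂ (refl , ℕP.≤-antisym (FP.toℕ<n i) (ℕP.≮⇒≥ i+1≮k))

  follows-prev : ∀ {k} (j : Fin k) → Follows (prev j) j
  follows-prev {suc m} zero    = inj₂ (refl , cong suc (FP.toℕ-fromℕ m))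
  follows-prev {suc m} (suc i) = inj₁ (cong suc (sym (FP.toℕ-inject₁ i)))

  follows-unique : ∀ {k} {i j j′ : Fin k} → Follows i j → Follows i j′ → j ≡ j′
  follows-unique (inj₁ e) (inj₁ e′) = FP.toℕ-injective (trans e (sym e′))
  follows-unique (inj₂ (e , _)) (inj₂ (e′ , _)) = FP.toℕ-injective (trans e (sym e′))
  follows-unique {j = j} (inj₁ e) (inj₂ (_ , i+1≡k)) =
    ⊥-elim (ℕP.<-irrefl (trans e i+1≡k) (FP.toℕ<n j))
  follows-unique {j′ = j′} (inj₂ (_ , i+1≡k)) (inj₁ e′) =
    ⊥-elim (ℕP.<-irrefl (trans e′ i+1≡k) (FP.toℕ<n j′))

  next-prev : ∀ {k} (j : Fin k) → next (prev j) ≡ j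
  next-prev j = follows-unique (next-follows (prev j)) (follows-prev j)

  private
    ∸-pred : ∀ m n → n ℕ.< m → m ℕ.∸ n ≡ suc (m ℕ.∸ suc n)
    ∸-pred (suc m) zero    _       = refl
    ∸-pred (suc m) (suc n) (s≤s p) = ∸-pred m n p

  follows-opposite : ∀ {k} {i j : Fin k} → Follows i j → Follows (opposite j) (opposite i)
  follows-opposite {k} {i} {j} (inj₁ j≡i+1) = inj₁ (begin
    toℕ (opposite i)               ≡⟨ FP.opposite-prop i ⟩
    k ℕ.∸ suc (toℕ i)              ≡⟨ ∸-pred k (suc (toℕ i)) (subst (ℕ._< k) j≡i+1 (FP.toℕ<n j)) ⟩
    suc (k ℕ.∸ suc (suc (toℕ i)))  ≡⟨ cong (λ x → suc (k ℕ.∸ suc x)) j≡i+1 ⟨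
    suc (k ℕ.∸ suc (toℕ j))        ≡⟨ cong suc (FP.opposite-prop j) ⟨
    suc (toℕ (opposite j))         ∎)
    where open ≡-Reasoning
  follows-opposite {suc m} {i} {j} (inj₂ (j≡0 , i+1≡k)) = inj₂
    ( trans (FP.opposite-prop i) (trans (cong (ℕ._∸ suc (toℕ i)) (sym i+1≡k)) (ℕP.n∸n≡0 (suc (toℕ i))))
    , cong suc (trans (FP.opposite-prop j) (cong (m ℕ.∸_) j≡0)))

open CyclicOrder

-- Such an f always has a leaf (a
-- point without preimage) off the cycle as long as k < N, and removing
-- a leaf leaves a unicyclic map with the same cycle.

Reaches : ∀ {N k} → (Fin N → Fin N) → (Fin k → Fin N) → Fin N → Set
Reaches f cyc x = ∃ λ m → ∃ λ i → iterate f x m ≡ cyc i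

module _ {N k : ℕ} {f : Fin N → Fin N} {cyc : Fin k → Fin N} where
  open ≡

  reaches-preimage : ∀ {x} → Reaches f cyc (f x) → Reaches f cyc x
  reaches-preimage (m , i , e) = suc m , i , e

  reaches-image : (∀ i → f (cyc i) ≡ cyc (next i)) → ∀ {x} → Reaches f cyc x → Reaches f cyc (f x)
  reaches-image closed (zero  , i , refl) = zero , next i , closed i
  reaches-image closed (suc m , i , e)    = m , i , e

record Unicyclic {N : ℕ} (f : Fin N → Fin N) (k : ℕ) : Set where
  field
    cyc          : Fin k → Fin N
    cyc-inj      : Injective _≡_ _≡_ cyc
    cyc-closed   : ∀ i → f (cyc i) ≡ cyc (next i)
    reaches      : ∀ x → Reaches f cyc x
    cyc-nonempty : 0 ℕ.< k

module _ where
  open ≡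

  injective-onto : ∀ {N} (g : Fin N → Fin N) → Injective _≡_ _≡_ g → ∀ z → ∃ λ x → g x ≡ z
  injective-onto {suc N} g g-inj z with FP.any? (λ x → g x FP.≟ z)
  ... | yes hit = hit
  ... | no miss = ⊥-elim (FP.<⇒notInjective (ℕP.n<1+n N) squeezed-inj)
    where
    z≢g : ∀ x → z ≢ g x
    z≢g x e = miss (x , sym e)
    squeezed-inj : Injective _≡_ _≡_ (λ x → punchOut (z≢g x))
    squeezed-inj e = g-inj (FP.punchOut-injective (z≢g _) (z≢g _) e)

  -- an onto endomap of a finite set is injective (via an injective section)
  onto-injective : ∀ {N} (f : Fin N → Fin N) → (∀ z → ∃ λ y → f y ≡ z) → Injective _≡_ _≡_ f
  onto-injective {N} f onto {y₁} {y₂} fy₁≡fy₂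
    with injective-onto g g-inj y₁ | injective-onto g g-inj y₂
    where
    g : Fin N → Fin N
    g = proj₁ ∘ onto
    g-inj : Injective _≡_ _≡_ g
    g-inj {a} {b} e = trans (sym (proj₂ (onto a))) (trans (cong f e) (proj₂ (onto b)))
  ... | x₁ , refl | x₂ , refl =
    cong (proj₁ ∘ onto) (trans (sym (proj₂ (onto x₁))) (trans fy₁≡fy₂ (proj₂ (onto x₂))))

  leaf-or-onto : ∀ {N} (f : Fin N → Fin N) → (∃ λ x → ∀ y → f y ≢ x) ⊎ (∀ z → ∃ λ y → f y ≡ z)
  leaf-or-onto {N} f with FP.all? (λ z → FP.any? (λ y → f y FP.≟ z))
  ... | yes onto = inj₂ onto
  ... | no ¬onto with FP.¬∀⟶∃¬ N _ (λ z → FP.any? (λ y → f y FP.≟ z)) ¬onto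
  ...   | x , no-preimage = inj₁ (x , λ y e → no-preimage (y , e))

module UnicyclicProperties {N k : ℕ} {f : Fin N → Fin N} (U : Unicyclic f k) where
  open Unicyclic U
  open ≡

  cyc-pred : ∀ j → f (cyc (prev j)) ≡ cyc j
  cyc-pred j = trans (cyc-closed (prev j)) (cong cyc (next-prev j))

  on-cycle : Injective _≡_ _≡_ f → ∀ m z i → iterate f z m ≡ cyc i → ∃ λ j → z ≡ cyc j
  on-cycle f-inj zero    z i e = i , e
  on-cycle f-inj (suc m) z i e with on-cycle f-inj m (f z) i e
  ... | j , fz≡cj = prev j , f-inj (trans fz≡cj (sym (cyc-pred j)))

  leaf : k ℕ.< N → ∃ λ x → ∀ y → f y ≢ x
  leaf k<N with leaf-or-onto f
  ... | inj₁ lf   = lf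
  ... | inj₂ onto = ⊥-elim (FP.<⇒notInjective k<N index-inj)
    where
    f-inj : Injective _≡_ _≡_ f
    f-inj = onto-injective f onto
    index : Fin N → Fin k
    index z = proj₁ (on-cycle f-inj (proj₁ (reaches z)) z _ (proj₂ (proj₂ (reaches z))))
    index-spec : ∀ z → z ≡ cyc (index z)
    index-spec z = proj₂ (on-cycle f-inj (proj₁ (reaches z)) z _ (proj₂ (proj₂ (reaches z))))
    index-inj : Injective _≡_ _≡_ index
    index-inj {a} {b} e = trans (index-spec a) (trans (cong cyc e) (sym (index-spec b)))

  leaf-off-cycle : ∀ {x} → (∀ y → f y ≢ x) → ∀ i → x ≢ cyc i
  leaf-off-cycle lf i e = lf (cyc (prev i)) (trans (cyc-pred i) (sym e))

module RemoveLeaf {N′ k : ℕ} {f : Fin (suc N′) → Fin (suc N′)} (U : Unicyclic f k)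
                  (x : Fin (suc N′)) (lf : ∀ y → f y ≢ x) where
  open Unicyclic U
  open UnicyclicProperties U
  open ≡

  private
    x≢f : ∀ a → x ≢ f (punchIn x a)
    x≢f a e = lf (punchIn x a) (sym e)

  f′ : Fin N′ → Fin N′
  f′ a = punchOut (x≢f a)

  punchIn-f′ : ∀ a → punchIn x (f′ a) ≡ f (punchIn x a)
  punchIn-f′ a = FP.punchIn-punchOut (x≢f a)

  private
    cyc′ : Fin k → Fin N′
    cyc′ i = punchOut (leaf-off-cycle lf i)

    punchIn-cyc′ : ∀ i → punchIn x (cyc′ i) ≡ cyc i
    punchIn-cyc′ i = FP.punchIn-punchOut (leaf-off-cycle lf i)

    punchIn-iterate : ∀ m a → punchIn x (iterate f′ a m) ≡ iterate f (punchIn x a) m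
    punchIn-iterate zero    a = refl
    punchIn-iterate (suc m) a =
      trans (punchIn-iterate m (f′ a)) (cong (λ y → iterate f y m) (punchIn-f′ a))

  unicyclic′ : Unicyclic f′ k
  unicyclic′ = record
    { cyc = cyc′
    ; cyc-inj = λ {i} {j} e → cyc-inj (FP.punchOut-injective (leaf-off-cycle lf i) (leaf-off-cycle lf j) e)
    ; cyc-closed = λ i → FP.punchIn-injective x _ _ (begin
        punchIn x (f′ (cyc′ i)) ≡⟨ punchIn-f′ (cyc′ i) ⟩
        f (punchIn x (cyc′ i))  ≡⟨ cong f (punchIn-cyc′ i) ⟩
        f (cyc i)               ≡⟨ cyc-closed i ⟩
        cyc (next i)            ≡⟨ punchIn-cyc′ (next i) ⟨
        punchIn x (cyc′ (next i)) ∎)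
    ; reaches = λ a → let (m , i , e) = reaches (punchIn x a) in
        m , i , FP.punchIn-injective x _ _ (trans (punchIn-iterate m a) (trans e (sym (punchIn-cyc′ i))))
    ; cyc-nonempty = cyc-nonempty
    }
    where open ≡-Reasoning

-- The inverse of a digraph-function is the
-- reverse of a digraph-function, and reversal transposes the
-- adjacency matrices of F and of all the derived digraphs, so the
-- inverse case of the theorem reduces to the function case.

reverse : ArcDigraph → ArcDigraph
reverse F = record
  { n = n F ; m = m F ; tl = hd F ; hd = tl F
  ; noMulti = λ e e′ p q → noMulti F e e′ q p }

module _ {F : ArcDigraph} where
  open ≡

  reverse-arc : ∀ {x y} → IsArc F y x → IsArc (reverse F) x y
  reverse-arc (e , tl≡y , hd≡x) = e , hd≡x , tl≡y

  reverse-arc⁻ : ∀ {x y} → IsArc (reverse F) x y → IsArc F y x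
  reverse-arc⁻ (e , hd≡x , tl≡y) = e , tl≡y , hd≡x

  reverse-connected : Connected F → Connected (reverse F)
  reverse-connected conn x y = walk (conn x y)
    where
    walk : ∀ {x y} → UWalk F x y → UWalk (reverse F) x y
    walk here      = here
    walk (fwd a w) = bwd (reverse-arc a) (walk w)
    walk (bwd a w) = fwd (reverse-arc a) (walk w)

  reverse-function : IsInverseDigraphFunction F → IsDigraphFunction (reverse F)
  reverse-function (f , arc⇔) = f , λ x y →
    mk⇔ (Equivalence.to (arc⇔ y x) ∘ reverse-arc⁻) (reverse-arc ∘ Equivalence.from (arc⇔ y x))

  reverse-cycle : ∀ {k} → HasDirectedCycle F k → HasDirectedCycle (reverse F) k
  reverse-cycle (c , c-inj , arcs , k>0) =
      (c ∘ opposite)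
    , (λ e → trans (sym (FP.opposite-involutive _)) (trans (cong opposite (c-inj e)) (FP.opposite-involutive _)))
    , (λ i j j-follows-i → reverse-arc (arcs (opposite j) (opposite i) (follows-opposite j-follows-i)))
    , k>0

  private
    anyFin-cong : ∀ {k} {p q : Fin k → Bool} → (∀ e → p e ≡ q e) → anyFin p ≡ anyFin q
    anyFin-cong {zero}  _   = refl
    anyFin-cong {suc k} p≡q = cong₂ _∨_ (p≡q zero) (anyFin-cong (p≡q ∘ suc))

  reverse-arc? : ∀ x y → arc? (reverse F) x y ≡ arc? F y x
  reverse-arc? x y = anyFin-cong (λ e → BP.∧-comm (hd F e == x) (tl F e == y))

  reverse-total : ∀ uF uL i j → Digraph.adj (total uF uL (reverse F)) i j ≡ Digraph.adj (total uF uL F) j i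
  reverse-total uF uL i j with splitAt (n F) i | splitAt (n F) j
  ... | inj₁ x | inj₁ y = cong (uF ∧_) (reverse-arc? x y)
  ... | inj₁ v | inj₂ e = refl
  ... | inj₂ e | inj₁ v = refl
  ... | inj₂ p | inj₂ q = cong (uL ∧_) (==-sym (tl F p) (hd F q))

↑ˡ≢↑ʳ : ∀ {p q} (a : Fin p) (b : Fin q) → a ↑ˡ q ≢ p ↑ʳ b
↑ˡ≢↑ʳ {p} {q} a b e
  with ≡.trans (≡.sym (FP.splitAt-↑ˡ p a q)) (≡.trans (≡.cong (splitAt p) e) (FP.splitAt-↑ʳ p q b))
... | ()

-- A digraph-function F with function f: every vertex x has exactly
-- one out-arc, arcOf x : x → f x.  Hence m = n, and numbering each arc
-- by its tail turns V ∪ E into two copies of V.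

module FunctionDigraph (F : ArcDigraph) (f : Fin (n F) → Fin (n F))
                       (arc⇔ : ∀ x y → IsArc F x y ⇔ (y ≡ f x)) where
  open ≡

  N : ℕ
  N = n F

  private
    arc-to-f : ∀ x → IsArc F x (f x)
    arc-to-f x = Equivalence.from (arc⇔ x (f x)) refl

    arc-head : ∀ {u v} → IsArc F u v → v ≡ f u
    arc-head {u} {v} = Equivalence.to (arc⇔ u v)

  arcOf : Fin N → Fin (m F)
  arcOf x = proj₁ (arc-to-f x)

  tl-arcOf : ∀ x → tl F (arcOf x) ≡ x
  tl-arcOf x = proj₁ (proj₂ (arc-to-f x))

  hd-arcOf : ∀ x → hd F (arcOf x) ≡ f x
  hd-arcOf x = proj₂ (proj₂ (arc-to-f x))

  arcOf-inj : Injective _≡_ _≡_ arcOf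
  arcOf-inj {a} {b} e = trans (sym (tl-arcOf a)) (trans (cong (tl F) e) (tl-arcOf b))

  arcOf-tl : ∀ e → arcOf (tl F e) ≡ e
  arcOf-tl e = noMulti F _ _ (tl-arcOf (tl F e))
                 (trans (hd-arcOf (tl F e)) (sym (arc-head (e , refl , refl))))

  m≡N : m F ≡ N
  m≡N = FP.cantor-schröder-bernstein {f = tl F}
          (λ {a} {b} e → trans (sym (arcOf-tl a)) (trans (cong arcOf e) (arcOf-tl b))) arcOf-inj

  arc?-f : ∀ x y → arc? F x y ≡ (f x == y)
  arc?-f x y with f x Fin.≟ y
  ... | yes refl = anyFin-true (arcOf x) (cong₂ _∧_ (==-yes (tl-arcOf x)) (==-yes (hd-arcOf x)))
    where
    ==-yes : ∀ {k} {i j : Fin k} → i ≡ j → (i == j) ≡ true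
    ==-yes refl = ==-refl _
    anyFin-true : ∀ {k} {p : Fin k → Bool} e → p e ≡ true → anyFin p ≡ true
    anyFin-true {p = p} zero    pe = cong (_∨ anyFin (p ∘ suc)) pe
    anyFin-true {p = p} (suc e) pe = trans (cong (p zero ∨_) (anyFin-true e pe)) (BP.∨-zeroʳ (p zero))
  ... | no fx≢y = anyFin-false not-arc
    where
    anyFin-false : ∀ {k} {p : Fin k → Bool} → (∀ e → p e ≡ false) → anyFin p ≡ false
    anyFin-false {zero}          _  = refl
    anyFin-false {suc k} {p} none = trans (cong (_∨ anyFin (p ∘ suc)) (none zero)) (anyFin-false (none ∘ suc))
    not-arc : ∀ e → ((tl F e == x) ∧ (hd F e == y)) ≡ false
    not-arc e with tl F e Fin.≟ x | hd F e Fin.≟ y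
    ... | yes refl | yes refl = ⊥-elim (fx≢y (sym (arc-head (e , refl , refl))))
    ... | yes _    | no _     = refl
    ... | no _     | _        = refl

  unicyclic : ∀ {k} → Connected F → HasDirectedCycle F k → Unicyclic f k
  unicyclic {zero}  _    (_ , _ , _ , ())
  unicyclic {suc _} conn (c , c-inj , arcs , k>0) = record
    { cyc = c ; cyc-inj = c-inj ; cyc-closed = closed
    ; reaches = λ x → along (conn x (c zero)) (zero , zero , refl)
    ; cyc-nonempty = k>0 }
    where
    closed : ∀ i → f (c i) ≡ c (next i)
    closed i = sym (arc-head (arcs i (next i) (next-follows i)))
    along : ∀ {x y} → UWalk F x y → Reaches f c y → Reaches f c x
    along here      r = r
    along (fwd a w) r = reaches-preimage (subst (Reaches f c) (arc-head a) (along w r))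
    along (bwd a w) r = subst (Reaches f c) (sym (arc-head a)) (reaches-image closed (along w r))

  κ : Fin (N ℕ.+ N) → Fin (N ℕ.+ m F)
  κ i with splitAt N i
  ... | inj₁ a = a ↑ˡ m F
  ... | inj₂ w = N ↑ʳ arcOf w

  κ-left : ∀ a → κ (a ↑ˡ N) ≡ a ↑ˡ m F
  κ-left a rewrite FP.splitAt-↑ˡ N a N = refl

  κ-right : ∀ w → κ (N ↑ʳ w) ≡ N ↑ʳ arcOf w
  κ-right w rewrite FP.splitAt-↑ʳ N N w = refl

  κ-inj : Injective _≡_ _≡_ κ
  κ-inj {i} {j} e with splitAt N i in si | splitAt N j in sj
  ... | inj₁ a | inj₁ b = trans (sym (FP.splitAt⁻¹-↑ˡ si))
                            (trans (cong (_↑ˡ N) (FP.↑ˡ-injective (m F) a b e)) (FP.splitAt⁻¹-↑ˡ sj))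
  ... | inj₂ p | inj₂ q = trans (sym (FP.splitAt⁻¹-↑ʳ si))
                            (trans (cong (N ↑ʳ_) (arcOf-inj (FP.↑ʳ-injective N _ _ e))) (FP.splitAt⁻¹-↑ʳ sj))
  ... | inj₁ a | inj₂ q = ⊥-elim (↑ˡ≢↑ʳ a (arcOf q) e)
  ... | inj₂ p | inj₁ b = ⊥-elim (↑ˡ≢↑ʳ b (arcOf p) (sym e))

  module _ (uF uL : Bool) where
    private
      adj′ : Fin (N ℕ.+ m F) → Fin (N ℕ.+ m F) → Bool
      adj′ = Digraph.adj (total uF uL F)
      M : ℕ
      M = m F

    adj-LL : ∀ a b → adj′ (κ (a ↑ˡ N)) (κ (b ↑ˡ N)) ≡ (uF ∧ (f a == b))
    adj-LL a b rewrite κ-left a | κ-left b | FP.splitAt-↑ˡ N a M | FP.splitAt-↑ˡ N b M =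
      cong (uF ∧_) (arc?-f a b)

    adj-LR : ∀ a w → adj′ (κ (a ↑ˡ N)) (κ (N ↑ʳ w)) ≡ (w == a)
    adj-LR a w rewrite κ-left a | κ-right w | FP.splitAt-↑ˡ N a M | FP.splitAt-↑ʳ N M (arcOf w) =
      cong (_== a) (tl-arcOf w)

    adj-RL : ∀ w b → adj′ (κ (N ↑ʳ w)) (κ (b ↑ˡ N)) ≡ (f w == b)
    adj-RL w b rewrite κ-left b | κ-right w | FP.splitAt-↑ˡ N b M | FP.splitAt-↑ʳ N M (arcOf w) =
      cong (_== b) (hd-arcOf w)

    adj-RR : ∀ p q → adj′ (κ (N ↑ʳ p)) (κ (N ↑ʳ q)) ≡ (uL ∧ (f p == q))
    adj-RR p q rewrite κ-right p | κ-right q | FP.splitAt-↑ʳ N M (arcOf p) | FP.splitAt-↑ʳ N M (arcOf q) =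
      cong (uL ∧_) (cong₂ _==_ (hd-arcOf p) (tl-arcOf q))

module Powers {c ℓ : Level} (R : CommutativeRing c ℓ) where
  open CommutativeRing R hiding (zero)
  open import Algebra.Properties.CommutativeSemiring.Exp commutativeSemiring
    using (_^_; ^-congˡ; ^-homo-*; ^-distrib-*)

  pow≡^ : ∀ x n → pow R x n ≡ x ^ n
  pow≡^ x zero    = ≡.refl
  pow≡^ x (suc n) = ≡.cong (x *_) (pow≡^ x n)

  pow-cong : ∀ {x y} n → x ≈ y → pow R x n ≈ pow R y n
  pow-cong {x} {y} n x≈y rewrite pow≡^ x n | pow≡^ y n = ^-congˡ n x≈y

  pow-+ : ∀ x a b → pow R x (a ℕ.+ b) ≈ pow R x a * pow R x b
  pow-+ x a b rewrite pow≡^ x (a ℕ.+ b) | pow≡^ x a | pow≡^ x b = ^-homo-* x a b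

  pow-* : ∀ x y n → pow R (x * y) n ≈ pow R x n * pow R y n
  pow-* x y n rewrite pow≡^ (x * y) n | pow≡^ x n | pow≡^ y n = ^-distrib-* x y n

  pow-square : ∀ t n → pow R (t * t) n ≈ pow R t (2 ℕ.* n)
  pow-square t n = begin
    pow R (t * t) n        ≈⟨ pow-* t t n ⟩
    pow R t n * pow R t n  ≈⟨ pow-+ t n n ⟨
    pow R t (n ℕ.+ n)      ≡⟨ ≡.cong (λ m → pow R t (n ℕ.+ m)) (ℕP.+-identityʳ n) ⟨
    pow R t (2 ℕ.* n)      ∎
    where open import Relation.Binary.Reasoning.Setoid setoid

  pow-1 : ∀ n → pow R 1# n ≈ 1#
  pow-1 zero    = refl
  pow-1 (suc n) = trans (*-identityˡ _) (pow-1 n)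

-- Defs defines det by Laplace
-- expansion along the first row; here we derive the expansion along
-- any column, and from it the usual calculus of determinants.

module Determinant {c ℓ : Level} (R : CommutativeRing c ℓ) where
  open CommutativeRing R hiding (zero)
  open import Algebra.Properties.Ring ring using (-‿distribˡ-*; -0#≈0#)
  open import Algebra.Properties.Semiring.Sum semiring public
    using (sum; sum-cong-≋; ∑-distrib-+; ∑-comm; sum-remove; *-distribˡ-sum; *-distribʳ-sum;
           sum-replicate-zero; sum-permute)
  open IntegerSolver R using (solve; _:+_; _:*_; :-_; _:-_; _:=_; :0; :1)
  open import Relation.Binary.Reasoning.Setoid setoid

  Matrix : ℕ → Set c
  Matrix n = Fin n → Fin n → Carrier

  minor : ∀ {n} → Fin (suc n) → Fin (suc n) → Matrix (suc n) → Matrix n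
  minor r s M a b = M (punchIn r a) (punchIn s b)

  transpose : ∀ {n} → Matrix n → Matrix n
  transpose M a b = M b a

  diagonal : ∀ {n} → Carrier → Matrix n
  diagonal d a b = if a == b then d else 0#

  I : ∀ {n} → Matrix n
  I = diagonal 1#

  sign : ∀ {n} → Fin n → Carrier
  sign i = sgn R (toℕ i)

  sum-zero : ∀ {k} {f : Fin k → Carrier} → (∀ i → f i ≈ 0#) → sum f ≈ 0#
  sum-zero {k} z = trans (sum-cong-≋ z) (sum-replicate-zero k)

  sum-single : ∀ {k} (j : Fin k) (f : Fin k → Carrier) → (∀ i → i ≢ j → f i ≈ 0#) → sum f ≈ f j
  sum-single {suc k} j f z = begin
    sum f                        ≈⟨ sum-remove {i = j} f ⟩
    f j + sum (f ∘ punchIn j)    ≈⟨ +-congˡ (sum-zero (λ i → z (punchIn j i) (FP.punchInᵢ≢i j i))) ⟩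
    f j + 0#                     ≈⟨ +-identityʳ _ ⟩
    f j                          ∎

  sum-split : ∀ p {q} (f : Fin (p ℕ.+ q) → Carrier) →
    sum f ≈ sum (λ a → f (a ↑ˡ q)) + sum (λ b → f (p ↑ʳ b))
  sum-split zero    f = sym (+-identityˡ _)
  sum-split (suc p) f = trans (+-congˡ (sum-split p (f ∘ suc))) (sym (+-assoc _ _ _))

  sum-neg : ∀ {k} (f : Fin k → Carrier) → sum (λ i → - f i) ≈ - sum f
  sum-neg {zero}  f = sym -0#≈0#
  sum-neg {suc k} f = trans (+-congˡ (sum-neg (f ∘ suc)))
    (solve 2 (λ a b → (:- a) :+ (:- b) := :- (a :+ b)) refl (f zero) _)

  sign² : ∀ {n} (i : Fin n) → sign i * sign i ≈ 1#
  sign² i = go (toℕ i)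
    where
    go : ∀ a → sgn R a * sgn R a ≈ 1#
    go zero    = *-identityˡ 1#
    go (suc a) = trans (solve 1 (λ x → (:- x) :* (:- x) := x :* x) refl (sgn R a)) (go a)

  private
    sumF≡sum : ∀ {k} (f : Fin k → Carrier) → sumF R f ≡ sum f
    sumF≡sum {zero}  f = ≡.refl
    sumF≡sum {suc k} f = ≡.cong (f zero +_) (sumF≡sum (f ∘ suc))

  det-row : ∀ {n} (M : Matrix (suc n)) → det R M ≈ sum (λ j → sign j * M zero j * det R (minor zero j M))
  det-row M = reflexive (sumF≡sum (λ j → sign j * M zero j * det R (minor zero j M)))

  det-cong : ∀ {n} {M N : Matrix n} → (∀ a b → M a b ≈ N a b) → det R M ≈ det R N
  det-cong {zero}          _   = refl
  det-cong {suc n} {M} {N} M≈N = begin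
    det R M                                                   ≈⟨ det-row M ⟩
    sum (λ j → sign j * M zero j * det R (minor zero j M))
      ≈⟨ sum-cong-≋ (λ j → *-cong (*-congˡ {sign j} (M≈N zero j)) (det-cong (λ a b → M≈N (suc a) (punchIn j b)))) ⟩
    sum (λ j → sign j * N zero j * det R (minor zero j N))    ≈⟨ det-row N ⟨
    det R N                                                   ∎

  det-cong≡ : ∀ {n} {M N : Matrix n} → (∀ a b → M a b ≡ N a b) → det R M ≈ det R N
  det-cong≡ M≡N = det-cong (λ a b → reflexive (M≡N a b))

  private
    -- deleting columns j = punchIn s l and then s (renumbered as punchOut)
    -- deletes the same two columns as deleting s and then l: the signs
    -- differ by a factor −1 …
    sign-punch : ∀ {n} (s : Fin (suc (suc n))) (l : Fin (suc n)) (ne : punchIn s l ≢ s) →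
      sign (punchIn s l) * sign (punchOut ne) ≈ - (sign s * sign l)
    sign-punch zero    l       ne = solve 1 (λ x → (:- x) :* :1 := :- (:1 :* x)) refl (sign l)
    sign-punch (suc s) zero    ne = solve 1 (λ x → :1 :* x := :- ((:- x) :* :1)) refl (sign s)
    sign-punch {suc n} (suc s) (suc l) ne = begin
      (- sign s′) * (- sign o)  ≈⟨ solve 2 (λ x y → (:- x) :* (:- y) := x :* y) refl (sign s′) (sign o) ⟩
      sign s′ * sign o          ≈⟨ sign-punch s l (ne ∘ ≡.cong suc) ⟩
      - (sign s * sign l)       ≈⟨ solve 2 (λ x y → :- (x :* y) := :- ((:- x) :* (:- y))) refl (sign s) (sign l) ⟩
      - ((- sign s) * (- sign l)) ∎
      where
      s′ = punchIn s l
      o  = punchOut (ne ∘ ≡.cong suc)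

    -- … and the remaining columns come in the same order
    punchIn-punchOut-swap : ∀ {n} (s : Fin (suc (suc n))) (l : Fin (suc n)) (ne : punchIn s l ≢ s) (b : Fin n) →
      punchIn (punchIn s l) (punchIn (punchOut ne) b) ≡ punchIn s (punchIn l b)
    punchIn-punchOut-swap zero    l       ne b = ≡.refl
    punchIn-punchOut-swap (suc s) zero    ne b = ≡.refl
    punchIn-punchOut-swap {suc n} (suc s) (suc l) ne zero    = ≡.refl
    punchIn-punchOut-swap {suc n} (suc s) (suc l) ne (suc b) =
      ≡.cong suc (punchIn-punchOut-swap s l (ne ∘ ≡.cong suc) b)

  ColExpansion : ℕ → Set (c ⊔ ℓ)
  ColExpansion n = ∀ (M : Matrix (suc n)) (s : Fin (suc n)) →
    det R M ≈ sum (λ r → (sign r * sign s) * M r s * det R (minor r s M))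

  private
    minor₂ : ∀ {n} → Matrix (suc (suc n)) → Fin (suc (suc n)) → Fin (suc n) → Fin (suc n) → Matrix n
    minor₂ M s r l a b = M (suc (punchIn r a)) (punchIn s (punchIn l b))

    -- a first-row term outside column s, expanded along column s of its minor
    row0-term : ∀ {n} → ColExpansion n → ∀ (M : Matrix (suc (suc n))) s l →
      sign (punchIn s l) * M zero (punchIn s l) * det R (minor zero (punchIn s l) M) ≈
      sum (λ r → (- (sign r * sign s) * M (suc r) s) * (sign l * M zero (punchIn s l) * det R (minor₂ M s r l)))
    row0-term expand M s l = begin
      x * M zero j * det R (minor zero j M)
        ≈⟨ *-congˡ (expand (minor zero j M) s′) ⟩
      x * M zero j * sum (λ r → (sign r * y) * M (suc r) (punchIn j s′) * det R (minor r s′ (minor zero j M)))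
        ≈⟨ *-distribˡ-sum (x * M zero j) (λ r → (sign r * y) * M (suc r) (punchIn j s′) * det R (minor r s′ (minor zero j M))) ⟩
      sum (λ r → x * M zero j * ((sign r * y) * M (suc r) (punchIn j s′) * det R (minor r s′ (minor zero j M))))
        ≈⟨ sum-cong-≋ (λ r → *-congˡ {x * M zero j} (*-cong (*-congˡ {sign r * y} (reflexive (≡.cong (M (suc r)) (FP.punchIn-punchOut j≢s))))
                                              (det-cong≡ (λ a b → ≡.cong (M (suc (punchIn r a))) (punchIn-punchOut-swap s l j≢s b))))) ⟩
      sum (λ r → x * M zero j * ((sign r * y) * M (suc r) s * det R (minor₂ M s r l)))
        ≈⟨ sum-cong-≋ regroup ⟩
      sum (λ r → (- (sign r * sign s) * M (suc r) s) * (sign l * M zero j * det R (minor₂ M s r l))) ∎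
      where
      j = punchIn s l
      j≢s : j ≢ s
      j≢s = FP.punchInᵢ≢i s l
      s′ = punchOut j≢s
      x = sign j
      y = sign s′
      regroup : ∀ r → x * M zero j * ((sign r * y) * M (suc r) s * det R (minor₂ M s r l))
                    ≈ (- (sign r * sign s) * M (suc r) s) * (sign l * M zero j * det R (minor₂ M s r l))
      regroup r = begin
        x * M zero j * ((sign r * y) * M (suc r) s * d)
          ≈⟨ solve 6 (λ x y z m n d → x :* m :* ((z :* y) :* n :* d) := (x :* y) :* (z :* m :* n :* d))
                     refl x y (sign r) (M zero j) (M (suc r) s) d ⟩
        (x * y) * (sign r * M zero j * M (suc r) s * d)
          ≈⟨ *-congʳ (sign-punch s l j≢s) ⟩
        - (sign s * sign l) * (sign r * M zero j * M (suc r) s * d)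
          ≈⟨ solve 6 (λ a b z m n d → :- (a :* b) :* (z :* m :* n :* d) := (:- (z :* a) :* n) :* (b :* m :* d))
                     refl (sign s) (sign l) (sign r) (M zero j) (M (suc r) s) d ⟩
        (- (sign r * sign s) * M (suc r) s) * (sign l * M zero j * d) ∎
        where d = det R (minor₂ M s r l)

  -- Laplace expansion along any column: expand along the first row, then
  -- each minor along column s, and exchange the two sums
  col-expansion : ∀ {n} → ColExpansion n
  col-expansion {zero} M zero =
    solve 2 (λ m d → :1 :* m :* d :+ :0 := :1 :* :1 :* m :* d :+ :0) refl (M zero zero) (det R (minor zero zero M))
  col-expansion {suc n} M s = begin
    det R M                                        ≈⟨ det-row M ⟩
    sum T                                          ≈⟨ sum-remove {i = s} T ⟩
    T s + sum (T ∘ punchIn s)                      ≈⟨ +-cong (solve 3 (λ x m d → x :* m :* d := :1 :* x :* m :* d) refl (sign s) (M zero s) _)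
                                                            (sum-cong-≋ (row0-term col-expansion M s)) ⟩
    U zero + sum (λ l → sum (λ r → V r l))         ≈⟨ +-congˡ (∑-comm (λ l r → V r l)) ⟩
    U zero + sum (λ r → sum (λ l → V r l))         ≈⟨ +-congˡ (sum-cong-≋ (λ r → trans (sym (*-distribˡ-sum (- (sign r * sign s) * M (suc r) s) (λ l → W r l)))
                                                        (*-cong (*-congʳ {M (suc r) s} (-‿distribˡ-* (sign r) (sign s))) (sym (det-row (minor (suc r) s M)))))) ⟩
    U zero + sum (U ∘ suc)                         ∎
    where
    T : Fin (suc (suc n)) → Carrier
    T j = sign j * M zero j * det R (minor zero j M)
    U : Fin (suc (suc n)) → Carrier
    U r = (sign r * sign s) * M r s * det R (minor r s M)
    W : Fin (suc n) → Fin (suc n) → Carrier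
    W r l = sign l * M zero (punchIn s l) * det R (minor₂ M s r l)
    V : Fin (suc n) → Fin (suc n) → Carrier
    V r l = (- (sign r * sign s) * M (suc r) s) * W r l

  det-transpose : ∀ {n} (M : Matrix n) → det R (transpose M) ≈ det R M
  det-transpose {zero}  M = refl
  det-transpose {suc n} M = begin
    det R (transpose M)
      ≈⟨ det-row (transpose M) ⟩
    sum (λ j → sign j * M j zero * det R (transpose (minor j zero M)))
      ≈⟨ sum-cong-≋ (λ j → *-cong (*-congʳ {M j zero} (sym (*-identityʳ (sign j)))) (det-transpose (minor j zero M))) ⟩
    sum (λ r → (sign r * 1#) * M r zero * det R (minor r zero M))
      ≈⟨ col-expansion M zero ⟨
    det R M ∎

  det-col-single : ∀ {n} (M : Matrix (suc n)) (x s : Fin (suc n)) → (∀ r → r ≢ x → M r s ≈ 0#) →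
    det R M ≈ (sign x * sign s) * M x s * det R (minor x s M)
  det-col-single M x s z = trans (col-expansion M s) (sum-single x _ vanish)
    where
    vanish : ∀ r → r ≢ x → (sign r * sign s) * M r s * det R (minor r s M) ≈ 0#
    vanish r r≢x = begin
      (sign r * sign s) * M r s * det R (minor r s M) ≈⟨ *-congʳ (*-congˡ (z r r≢x)) ⟩
      (sign r * sign s) * 0# * det R (minor r s M)    ≈⟨ *-congʳ (zeroʳ _) ⟩
      0# * det R (minor r s M)                        ≈⟨ zeroˡ _ ⟩
      0#                                              ∎

  det-col-diagonal : ∀ {n} (M : Matrix (suc n)) (x : Fin (suc n)) → (∀ r → r ≢ x → M r x ≈ 0#) →
    det R M ≈ M x x * det R (minor x x M)
  det-col-diagonal M x z = trans (det-col-single M x x z)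
    (*-congʳ (trans (*-congʳ (sign² x)) (*-identityˡ _)))

  det-diagonal : ∀ {n} (d : Carrier) → det R (diagonal {n} d) ≈ pow R d n
  det-diagonal {zero}  d = refl
  det-diagonal {suc n} d = begin
    det R (diagonal {suc n} d)
      ≈⟨ det-col-diagonal (diagonal {suc n} d) zero (λ r r≢0 → reflexive (≡.cong (if_then d else 0#) (==-≢ r≢0))) ⟩
    diagonal {suc n} d zero zero * det R (minor zero zero (diagonal {suc n} d))
      ≈⟨ *-cong (reflexive (≡.cong (if_then d else 0#) (==-refl {suc n} zero)))
                (det-cong≡ {n} (λ a b → ≡.cong (if_then d else 0#) (==-injective suc FP.suc-injective a b))) ⟩
    d * det R (diagonal {n} d)
      ≈⟨ *-congˡ (det-diagonal {n} d) ⟩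
    pow R d (suc n) ∎

  det-I : ∀ {n} → det R (I {n}) ≈ 1#
  det-I {n} = trans (det-diagonal {n} 1#) (Powers.pow-1 R n)

  sum-I-right : ∀ {n} (f : Fin n → Carrier) a → sum (λ l → f l * I a l) ≈ f a
  sum-I-right f a = trans (sum-single a (λ l → f l * I a l) off-diagonal)
                          (trans (*-congˡ (reflexive (≡.cong (if_then 1# else 0#) (==-refl a)))) (*-identityʳ _))
    where
    off-diagonal : ∀ l → l ≢ a → f l * I a l ≈ 0#
    off-diagonal l l≢a = trans (*-congˡ (reflexive (≡.cong (if_then 1# else 0#) (==-≢ (l≢a ∘ ≡.sym))))) (zeroʳ _)

  sum-I-left : ∀ {n} (f : Fin n → Carrier) b → sum (λ l → I l b * f l) ≈ f b
  sum-I-left f b = trans (sum-cong-≋ (λ l → *-comm (I l b) (f l)))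
    (trans (sum-cong-≋ (λ l → *-congˡ (reflexive (≡.cong (if_then 1# else 0#) (==-sym l b))))) (sum-I-right f b))

injection⇒permutation : ∀ {n} (κ : Fin n → Fin n) → Injective _≡_ _≡_ κ → Permutation′ n
injection⇒permutation κ κ-inj = Perm.permutation κ (proj₁ ∘ onto)
  (proj₂ ∘ onto) (λ x → κ-inj (proj₂ (onto (κ x))))
  where onto = injective-onto κ κ-inj

module _ {n : ℕ} where
  open ≡

  permutation-injective : (π : Permutation′ n) → Injective _≡_ _≡_ (π ⟨$⟩ʳ_)
  permutation-injective π e = trans (sym (Perm.inverseˡ π)) (trans (cong (π ⟨$⟩ˡ_) e) (Perm.inverseˡ π))

-- Permuting rows and columns multiplies the determinant by that of the
-- permutation matrix, whose square has determinant 1; so renumbering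
-- all indices at once does not change the determinant.

module Permuting {c ℓ : Level} (R : CommutativeRing c ℓ) where
  open CommutativeRing R hiding (zero)
  open Determinant R
  open IntegerSolver R using (solve; _:*_; _:=_)
  open import Relation.Binary.Reasoning.Setoid setoid

  permMatrix : ∀ {n} → Permutation′ n → Matrix n
  permMatrix π a b = if a == (π ⟨$⟩ʳ b) then 1# else 0#

  det-permMatrix : ∀ {n} (π : Permutation′ (suc n)) (j : Fin (suc n)) →
    det R (permMatrix π) ≈ (sign (π ⟨$⟩ʳ j) * sign j) * det R (permMatrix (Perm.remove j π))
  det-permMatrix π j = begin
    det R (permMatrix π)
      ≈⟨ det-col-single (permMatrix π) πj j (λ r r≢πj → reflexive (≡.cong (if_then 1# else 0#) (==-≢ r≢πj))) ⟩
    (sign πj * sign j) * permMatrix π πj j * det R (minor πj j (permMatrix π))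
      ≈⟨ *-cong (trans (*-congˡ {sign πj * sign j} (reflexive (≡.cong (if_then 1# else 0#) (==-refl πj)))) (*-identityʳ _))
                (det-cong≡ (λ a b → ≡.cong (if_then 1# else 0#)
                   (≡.trans (≡.cong (punchIn πj a ==_) (Perm.punchIn-permute π j b))
                            (==-injective (punchIn πj) (FP.punchIn-injective πj _ _) a _)))) ⟩
    (sign πj * sign j) * det R (permMatrix (Perm.remove j π)) ∎
    where
    πj = π ⟨$⟩ʳ j

  private
    -- the two signs in det-permMatrix cancel when moved to the other side
    det-permMatrix-remove : ∀ {n} (π : Permutation′ (suc n)) (j : Fin (suc n)) →
      det R (permMatrix (Perm.remove j π)) ≈ (sign (π ⟨$⟩ʳ j) * sign j) * det R (permMatrix π)
    det-permMatrix-remove π j = begin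
      det R P′                 ≈⟨ *-identityˡ _ ⟨
      1# * det R P′            ≈⟨ *-congʳ s²≈1 ⟨
      (s * s) * det R P′       ≈⟨ *-assoc s s _ ⟩
      s * (s * det R P′)       ≈⟨ *-congˡ (det-permMatrix π j) ⟨
      s * det R (permMatrix π) ∎
      where
      s  = sign (π ⟨$⟩ʳ j) * sign j
      P′ = permMatrix (Perm.remove j π)
      s²≈1 : s * s ≈ 1#
      s²≈1 = trans (solve 2 (λ a b → (a :* b) :* (a :* b) := (a :* a) :* (b :* b)) refl (sign (π ⟨$⟩ʳ j)) (sign j))
                   (trans (*-cong (sign² (π ⟨$⟩ʳ j)) (sign² j)) (*-identityˡ 1#))

  det-permute-cols : ∀ {n} (M : Matrix n) (π : Permutation′ n) →
    det R (λ a b → M a (π ⟨$⟩ʳ b)) ≈ det R (permMatrix π) * det R M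
  det-permute-cols {zero}  M π = sym (*-identityˡ 1#)
  det-permute-cols {suc n} M π = begin
    det R (λ a b → M a (π ⟨$⟩ʳ b))
      ≈⟨ det-row (λ a b → M a (π ⟨$⟩ʳ b)) ⟩
    sum (λ j → sign j * M zero (π ⟨$⟩ʳ j) * det R (λ a b → M (suc a) (π ⟨$⟩ʳ punchIn j b)))
      ≈⟨ sum-cong-≋ term ⟩
    sum (λ j → det R P * g (π ⟨$⟩ʳ j))
      ≈⟨ *-distribˡ-sum (det R P) (λ j → g (π ⟨$⟩ʳ j)) ⟨
    det R P * sum (λ j → g (π ⟨$⟩ʳ j))
      ≈⟨ *-congˡ (sum-permute g π) ⟨
    det R P * sum g
      ≈⟨ *-congˡ (det-row M) ⟨
    det R P * det R M ∎
    where
    P = permMatrix π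
    g : Fin (suc n) → Carrier
    g J = sign J * M zero J * det R (minor zero J M)
    term : ∀ j → sign j * M zero (π ⟨$⟩ʳ j) * det R (λ a b → M (suc a) (π ⟨$⟩ʳ punchIn j b)) ≈ det R P * g (π ⟨$⟩ʳ j)
    term j = begin
      sign j * M₀ * det R (λ a b → M (suc a) (π ⟨$⟩ʳ punchIn j b))
        ≈⟨ *-congˡ (det-cong≡ (λ a b → ≡.cong (M (suc a)) (Perm.punchIn-permute π j b))) ⟩
      sign j * M₀ * det R (λ a b → minor zero πj M a (π′ ⟨$⟩ʳ b))
        ≈⟨ *-congˡ (det-permute-cols (minor zero πj M) π′) ⟩
      sign j * M₀ * (det R (permMatrix π′) * d)
        ≈⟨ *-congˡ (*-congʳ (det-permMatrix-remove π j)) ⟩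
      sign j * M₀ * ((sign πj * sign j * det R P) * d)
        ≈⟨ solve 5 (λ x u y p d → x :* u :* ((y :* x :* p) :* d) := (x :* x) :* (p :* (y :* u :* d)))
                   refl (sign j) M₀ (sign πj) (det R P) d ⟩
      (sign j * sign j) * (det R P * g πj)
        ≈⟨ trans (*-congʳ (sign² j)) (*-identityˡ _) ⟩
      det R P * g πj ∎
      where
      πj = π ⟨$⟩ʳ j
      π′ = Perm.remove j π
      M₀ = M zero πj
      d  = det R (minor zero πj M)

  det-permute-rows : ∀ {n} (M : Matrix n) (π : Permutation′ n) →
    det R (λ a b → M (π ⟨$⟩ʳ a) b) ≈ det R (permMatrix π) * det R M
  det-permute-rows M π = begin
    det R (λ a b → M (π ⟨$⟩ʳ a) b)             ≈⟨ det-transpose (λ a b → M (π ⟨$⟩ʳ a) b) ⟨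
    det R (λ a b → transpose M a (π ⟨$⟩ʳ b))   ≈⟨ det-permute-cols (transpose M) π ⟩
    det R (permMatrix π) * det R (transpose M) ≈⟨ *-congˡ (det-transpose M) ⟩
    det R (permMatrix π) * det R M             ∎

  -- applying π to the rows of its own matrix gives the identity
  det-permMatrix² : ∀ {n} (π : Permutation′ n) → det R (permMatrix π) * det R (permMatrix π) ≈ 1#
  det-permMatrix² {n} π = begin
    det R (permMatrix π) * det R (permMatrix π) ≈⟨ det-permute-rows (permMatrix π) π ⟨
    det R (λ a b → permMatrix π (π ⟨$⟩ʳ a) b)   ≈⟨ det-cong≡ (λ a b → ≡.cong (if_then 1# else 0#)
                                                      (==-injective (π ⟨$⟩ʳ_) (permutation-injective π) a b)) ⟩
    det R (I {n})                               ≈⟨ det-I {n} ⟩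
    1#                                          ∎

  det-relabel : ∀ {n} (M : Matrix n) (π : Permutation′ n) →
    det R (λ a b → M (π ⟨$⟩ʳ a) (π ⟨$⟩ʳ b)) ≈ det R M
  det-relabel M π = begin
    det R (λ a b → M (π ⟨$⟩ʳ a) (π ⟨$⟩ʳ b))   ≈⟨ det-permute-rows (λ a b → M a (π ⟨$⟩ʳ b)) π ⟩
    p * det R (λ a b → M a (π ⟨$⟩ʳ b))        ≈⟨ *-congˡ (det-permute-cols M π) ⟩
    p * (p * det R M)                          ≈⟨ *-assoc p p _ ⟨
    (p * p) * det R M                          ≈⟨ trans (*-congʳ (det-permMatrix² π)) (*-identityˡ _) ⟩
    det R M                                    ∎
    where p = det R (permMatrix π)

  det-relabel-injective : ∀ {k n} → k ≡ n → (M : Matrix n) (κ : Fin k → Fin n) → Injective _≡_ _≡_ κ →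
    det R (λ a b → M (κ a) (κ b)) ≈ det R M
  det-relabel-injective ≡.refl M κ κ-inj = det-relabel M (injection⇒permutation κ κ-inj)

  det-zero-permute-cols : ∀ {n} (M : Matrix n) (π : Permutation′ n) →
    det R (λ a b → M a (π ⟨$⟩ʳ b)) ≈ 0# → det R M ≈ 0#
  det-zero-permute-cols M π z = begin
    det R M                          ≈⟨ trans (*-congʳ (det-permMatrix² π)) (*-identityˡ _) ⟨
    (p * p) * det R M                ≈⟨ *-assoc p p _ ⟩
    p * (p * det R M)                ≈⟨ *-congˡ (det-permute-cols M π) ⟨
    p * det R (λ a b → M a (π ⟨$⟩ʳ b)) ≈⟨ *-congˡ z ⟩
    p * 0#                           ≈⟨ zeroʳ p ⟩
    0#                               ∎
    where p = det R (permMatrix π)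

module _ {n : ℕ} where
  open ≡

  swap : Fin n → Fin n → Fin n → Fin n
  swap i j = Perm.transpose i j ⟨$⟩ʳ_

  swap-left : ∀ i j → swap i j i ≡ j
  swap-left i j rewrite dec-true (i Fin.≟ i) refl = refl

  swap-other : ∀ i j k → k ≢ i → k ≢ j → swap i j k ≡ k
  swap-other i j k k≢i k≢j rewrite dec-false (k Fin.≟ i) k≢i | dec-false (k Fin.≟ j) k≢j = refl

module ColumnOperations {c ℓ : Level} (R : CommutativeRing c ℓ) where
  open CommutativeRing R hiding (zero)
  open Determinant R
  open Permuting R
  open IntegerSolver R using (solve; _:+_; _:*_; :-_; _:=_; :0)
  open import Relation.Binary.Reasoning.Setoid setoid

  private
    punchOut-adjacent : ∀ {n} (j c₁ c₂ : Fin (suc n)) (j≢c₁ : j ≢ c₁) (j≢c₂ : j ≢ c₂) →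
      toℕ c₂ ≡ suc (toℕ c₁) → toℕ (punchOut j≢c₂) ≡ suc (toℕ (punchOut j≢c₁))
    punchOut-adjacent zero zero c₂ j≢c₁ _ _ = ⊥-elim (j≢c₁ ≡.refl)
    punchOut-adjacent zero (suc c₁) (suc c₂) _ _ e = ℕP.suc-injective e
    punchOut-adjacent {suc n} (suc zero) zero (suc zero) _ j≢c₂ _ = ⊥-elim (j≢c₂ ≡.refl)
    punchOut-adjacent {suc (suc n)} (suc (suc j)) zero (suc zero) _ _ _ = ≡.refl
    punchOut-adjacent {suc n} (suc j) (suc c₁) (suc c₂) j≢c₁ j≢c₂ e =
      ≡.cong suc (punchOut-adjacent j c₁ c₂ (j≢c₁ ∘ ≡.cong suc) (j≢c₂ ∘ ≡.cong suc) (ℕP.suc-injective e))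

    punchIn-adjacent : ∀ {n} (c₁ c₂ : Fin (suc n)) (b : Fin n) → toℕ c₂ ≡ suc (toℕ c₁) →
      punchIn c₁ b ≡ punchIn c₂ b ⊎ (punchIn c₁ b ≡ c₂ × punchIn c₂ b ≡ c₁)
    punchIn-adjacent zero (suc zero) zero    _ = inj₂ (≡.refl , ≡.refl)
    punchIn-adjacent zero (suc zero) (suc b) _ = inj₁ ≡.refl
    punchIn-adjacent (suc c₁) (suc c₂) zero  _ = inj₁ ≡.refl
    punchIn-adjacent (suc c₁) (suc c₂) (suc b) e with punchIn-adjacent c₁ c₂ b (ℕP.suc-injective e)
    ... | inj₁ same         = inj₁ (≡.cong suc same)
    ... | inj₂ (p₁ , p₂)    = inj₂ (≡.cong suc p₁ , ≡.cong suc p₂)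

  AdjacentEqualColsVanish : ℕ → Set (c ⊔ ℓ)
  AdjacentEqualColsVanish n = ∀ (M : Matrix n) (c₁ c₂ : Fin n) → toℕ c₂ ≡ suc (toℕ c₁) →
    (∀ a → M a c₁ ≈ M a c₂) → det R M ≈ 0#

  private
    -- expanding along the first row, all minors but two inherit the equal
    -- columns, and the remaining two terms cancel
    adjacent-step : ∀ n → AdjacentEqualColsVanish (suc n) → AdjacentEqualColsVanish (suc (suc n))
    adjacent-step n IH M c₁ c₂ adj M₁≈M₂ = begin
      det R M                        ≈⟨ det-row M ⟩
      sum T                          ≈⟨ sum-remove {i = c₁} T ⟩
      T c₁ + sum (T ∘ punchIn c₁)    ≈⟨ +-congˡ (sum-single l₂ (T ∘ punchIn c₁) other-columns) ⟩
      T c₁ + T (punchIn c₁ l₂)       ≡⟨ ≡.cong (λ c → T c₁ + T c) (FP.punchIn-punchOut c₁≢c₂) ⟩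
      T c₁ + T c₂                    ≈⟨ +-congˡ (*-cong (*-cong (reflexive (≡.cong (sgn R) adj)) (sym (M₁≈M₂ zero)))
                                                        (sym (det-cong same-minor))) ⟩
      T c₁ + (- sign c₁) * M zero c₁ * det R (minor zero c₁ M)
                                     ≈⟨ solve 3 (λ s u d → s :* u :* d :+ (:- s) :* u :* d := :0)
                                                refl (sign c₁) (M zero c₁) (det R (minor zero c₁ M)) ⟩
      0#                             ∎
      where
      T : Fin (suc (suc n)) → Carrier
      T j = sign j * M zero j * det R (minor zero j M)
      c₁≢c₂ : c₁ ≢ c₂
      c₁≢c₂ e = ℕP.1+n≢n (≡.sym (≡.trans (≡.cong toℕ e) adj))
      l₂ = punchOut c₁≢c₂
      other-columns : ∀ l → l ≢ l₂ → T (punchIn c₁ l) ≈ 0#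
      other-columns l l≢l₂ = trans (*-congˡ (IH (minor zero j M) c₁′ c₂′
                                     (punchOut-adjacent j c₁ c₂ j≢c₁ j≢c₂ adj) equal))
                                   (zeroʳ _)
        where
        j = punchIn c₁ l
        j≢c₁ : j ≢ c₁
        j≢c₁ = FP.punchInᵢ≢i c₁ l
        j≢c₂ : j ≢ c₂
        j≢c₂ e = l≢l₂ (FP.punchIn-injective c₁ l l₂ (≡.trans e (≡.sym (FP.punchIn-punchOut c₁≢c₂))))
        c₁′ = punchOut j≢c₁
        c₂′ = punchOut j≢c₂
        equal : ∀ a → minor zero j M a c₁′ ≈ minor zero j M a c₂′
        equal a = begin
          M (suc a) (punchIn j c₁′) ≡⟨ ≡.cong (M (suc a)) (FP.punchIn-punchOut j≢c₁) ⟩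
          M (suc a) c₁              ≈⟨ M₁≈M₂ (suc a) ⟩
          M (suc a) c₂              ≡⟨ ≡.cong (M (suc a)) (FP.punchIn-punchOut j≢c₂) ⟨
          M (suc a) (punchIn j c₂′) ∎
      same-minor : ∀ a b → minor zero c₁ M a b ≈ minor zero c₂ M a b
      same-minor a b with punchIn-adjacent c₁ c₂ b adj
      ... | inj₁ same = reflexive (≡.cong (M (suc a)) same)
      ... | inj₂ (p₁ , p₂) = begin
        M (suc a) (punchIn c₁ b) ≡⟨ ≡.cong (M (suc a)) p₁ ⟩
        M (suc a) c₂             ≈⟨ M₁≈M₂ (suc a) ⟨
        M (suc a) c₁             ≡⟨ ≡.cong (M (suc a)) p₂ ⟨
        M (suc a) (punchIn c₂ b) ∎

  det-adjacent-equal-cols : ∀ n → AdjacentEqualColsVanish n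
  det-adjacent-equal-cols (suc zero)    M zero zero ()
  det-adjacent-equal-cols (suc (suc n)) = adjacent-step n (det-adjacent-equal-cols (suc n))

  private
    det-equal-cols< : ∀ {n} (M : Matrix n) (c₁ c₂ : Fin n) → toℕ c₁ ℕ.< toℕ c₂ →
      (∀ a → M a c₁ ≈ M a c₂) → det R M ≈ 0#
    det-equal-cols< {n} M c₁ c₂ c₁<c₂ M₁≈M₂ = det-zero-permute-cols M π
      (det-adjacent-equal-cols n (λ a b → M a (π ⟨$⟩ʳ b)) c₁ d (FP.toℕ-fromℕ< d<n) equal)
      where
      d<n : suc (toℕ c₁) ℕ.< n
      d<n = ℕP.≤-<-trans c₁<c₂ (FP.toℕ<n c₂)
      -- the neighbour of c₁, swapped with c₂
      d = Fin.fromℕ< d<n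
      π = Perm.transpose d c₂
      c₁≢d : c₁ ≢ d
      c₁≢d e = ℕP.1+n≢n (≡.sym (≡.trans (≡.cong toℕ e) (FP.toℕ-fromℕ< d<n)))
      c₁≢c₂ : c₁ ≢ c₂
      c₁≢c₂ e = ℕP.<-irrefl (≡.cong toℕ e) c₁<c₂
      equal : ∀ a → M a (π ⟨$⟩ʳ c₁) ≈ M a (π ⟨$⟩ʳ d)
      equal a = begin
        M a (swap d c₂ c₁) ≡⟨ ≡.cong (M a) (swap-other d c₂ c₁ c₁≢d c₁≢c₂) ⟩
        M a c₁             ≈⟨ M₁≈M₂ a ⟩
        M a c₂             ≡⟨ ≡.cong (M a) (swap-left d c₂) ⟨
        M a (swap d c₂ d)  ∎

  det-equal-cols : ∀ {n} (M : Matrix n) (c₁ c₂ : Fin n) → c₁ ≢ c₂ → (∀ a → M a c₁ ≈ M a c₂) → det R M ≈ 0#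
  det-equal-cols M c₁ c₂ c₁≢c₂ M₁≈M₂ with ℕP.<-cmp (toℕ c₁) (toℕ c₂)
  ... | tri< c₁<c₂ _ _ = det-equal-cols< M c₁ c₂ c₁<c₂ M₁≈M₂
  ... | tri≈ _ e _     = ⊥-elim (c₁≢c₂ (FP.toℕ-injective e))
  ... | tri> _ _ c₂<c₁ = det-equal-cols< M c₂ c₁ c₂<c₁ (λ a → sym (M₁≈M₂ a))

  det-col-linear : ∀ {n m} (K : Matrix (suc n)) (s : Fin (suc n)) (N : Fin m → Matrix (suc n)) (w : Fin m → Carrier) →
    (∀ l a b → b ≢ s → N l a b ≈ K a b) → (∀ a → K a s ≈ sum (λ l → w l * N l a s)) →
    det R K ≈ sum (λ l → w l * det R (N l))
  det-col-linear {n} {m} K s N w others column-s = begin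
    det R K
      ≈⟨ col-expansion K s ⟩
    sum (λ r → σ r * K r s * det R (minor r s K))
      ≈⟨ sum-cong-≋ expand-entry ⟩
    sum (λ r → sum (λ l → w l * (σ r * N l r s * det R (minor r s (N l)))))
      ≈⟨ ∑-comm (λ r l → w l * (σ r * N l r s * det R (minor r s (N l)))) ⟩
    sum (λ l → sum (λ r → w l * (σ r * N l r s * det R (minor r s (N l)))))
      ≈⟨ sum-cong-≋ (λ l → sym (*-distribˡ-sum (w l) (λ r → σ r * N l r s * det R (minor r s (N l))))) ⟩
    sum (λ l → w l * sum (λ r → σ r * N l r s * det R (minor r s (N l))))
      ≈⟨ sum-cong-≋ (λ l → *-congˡ (col-expansion (N l) s)) ⟨
    sum (λ l → w l * det R (N l)) ∎
    where
    σ : Fin (suc n) → Carrier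
    σ r = sign r * sign s
    expand-entry : ∀ r → σ r * K r s * det R (minor r s K) ≈ sum (λ l → w l * (σ r * N l r s * det R (minor r s (N l))))
    expand-entry r = begin
      σ r * K r s * det R (minor r s K)
        ≈⟨ *-congʳ (*-congˡ (column-s r)) ⟩
      σ r * sum (λ l → w l * N l r s) * det R (minor r s K)
        ≈⟨ *-congʳ (*-distribˡ-sum (σ r) (λ l → w l * N l r s)) ⟩
      sum (λ l → σ r * (w l * N l r s)) * det R (minor r s K)
        ≈⟨ *-distribʳ-sum (det R (minor r s K)) (λ l → σ r * (w l * N l r s)) ⟩
      sum (λ l → σ r * (w l * N l r s) * det R (minor r s K))
        ≈⟨ sum-cong-≋ (λ l → trans
             (*-congˡ (det-cong (λ a b → sym (others l (punchIn r a) (punchIn s b) (FP.punchInᵢ≢i s b)))))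
             (solve 4 (λ x y z d → x :* (y :* z) :* d := y :* (x :* z :* d)) refl (σ r) (w l) (N l r s) (det R (minor r s (N l))))) ⟩
      sum (λ l → w l * (σ r * N l r s * det R (minor r s (N l)))) ∎

  det-col-add : ∀ {n} (M K : Matrix (suc n)) (s : Fin (suc n)) (w : Fin (suc n) → Carrier) → w s ≈ 0# →
    (∀ a b → b ≢ s → K a b ≈ M a b) → (∀ a → K a s ≈ M a s + sum (λ l → w l * M a l)) → det R K ≈ det R M
  det-col-add {n} M K s w ws≈0 others column-s = begin
    det R K                        ≈⟨ det-col-linear K s N w′ others′ column-s′ ⟩
    sum (λ l → w′ l * det R (N l)) ≈⟨ +-cong (*-identityˡ _) (sum-zero copies-vanish) ⟩
    det R M + 0#                   ≈⟨ +-identityʳ _ ⟩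
    det R M                        ∎
    where
    copy : Fin (suc n) → Matrix (suc n)
    copy l a b = if b == s then M a l else M a b
    N : Fin (suc (suc n)) → Matrix (suc n)
    N zero    = M
    N (suc l) = copy l
    w′ : Fin (suc (suc n)) → Carrier
    w′ zero    = 1#
    w′ (suc l) = w l
    others′ : ∀ l a b → b ≢ s → N l a b ≈ K a b
    others′ zero    a b b≢s = sym (others a b b≢s)
    others′ (suc l) a b b≢s = trans (reflexive (≡.cong (if_then M a l else M a b) (==-≢ b≢s))) (sym (others a b b≢s))
    column-s′ : ∀ a → K a s ≈ sum (λ l → w′ l * N l a s)
    column-s′ a = trans (column-s a) (+-cong (sym (*-identityˡ _))
      (sum-cong-≋ (λ l → *-congˡ {w l} (reflexive (≡.cong (if_then M a l else M a s) (≡.sym (==-refl s)))))))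
    copies-vanish : ∀ l → w l * det R (copy l) ≈ 0#
    copies-vanish l with l Fin.≟ s
    ... | yes ≡.refl = trans (*-congʳ ws≈0) (zeroˡ _)
    ... | no l≢s     = trans (*-congˡ (det-equal-cols (copy l) s l (l≢s ∘ ≡.sym) same)) (zeroʳ _)
      where
      same : ∀ a → copy l a s ≈ copy l a l
      same a = reflexive (≡.trans (≡.cong (if_then M a l else M a s) (==-refl s))
                                  (≡.sym (≡.cong (if_then M a l else M a l) (==-≢ l≢s))))

  -- adding to every column j in S a combination Σ_l W l j · (column l) of
  -- columns outside S, all at once; done one column at a time, in order
  det-cols-add : ∀ {n} (M K : Matrix n) (S : Fin n → Bool) (W : Fin n → Fin n → Carrier) →
    (∀ l j → S l ≡ true → W l j ≈ 0#) →
    (∀ a j → S j ≡ false → K a j ≈ M a j) →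
    (∀ a j → S j ≡ true → K a j ≈ M a j + sum (λ l → W l j * M a l)) → det R K ≈ det R M
  det-cols-add {zero}  M K S W _ _ _ = refl
  det-cols-add {suc n} M K S W W-out K-out K-in = begin
    det R K               ≈⟨ det-cong all-done ⟩
    det R (done (suc n))  ≈⟨ upto (suc n) ℕP.≤-refl ⟩
    det R M               ∎
    where
    new : Matrix (suc n)
    new a j = M a j + sum (λ l → W l j * M a l)
    below : Fin (suc n) → ℕ → Bool
    below j k = does (toℕ j ℕ.<? k)
    done : ℕ → Matrix (suc n)
    done k a j = if S j ∧ below j k then new a j else M a j

    below-suc : ∀ j k → toℕ j ≢ k → below j (suc k) ≡ below j k
    below-suc j k j≢k with toℕ j ℕ.<? k
    ... | yes j<k = ≡.trans (dec-true (toℕ j ℕ.<? suc k) (ℕP.m<n⇒m<1+n j<k)) (≡.sym (dec-true (toℕ j ℕ.<? k) j<k))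
    ... | no j≮k  = ≡.trans (dec-false (toℕ j ℕ.<? suc k) (λ j<k+1 → j≮k (ℕP.≤∧≢⇒< (ℕ.s≤s⁻¹ j<k+1) j≢k)))
                            (≡.sym (dec-false (toℕ j ℕ.<? k) j≮k))

    all-done : ∀ a j → K a j ≈ done (suc n) a j
    all-done a j with S j in Sj
    ... | true  = trans (K-in a j Sj) (reflexive (≡.cong (if_then new a j else M a j)
                                        (≡.sym (dec-true (toℕ j ℕ.<? suc n) (FP.toℕ<n j)))))
    ... | false = K-out a j Sj

    step : ∀ k (j : Fin (suc n)) → toℕ j ≡ k → det R (done (suc k)) ≈ det R (done k)
    step k j j≡k with S j in Sj
    ... | true = det-col-add (done k) (done (suc k)) j (λ l → W l j) (W-out j j Sj) unchanged changed
      where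
      unchanged : ∀ a b → b ≢ j → done (suc k) a b ≈ done k a b
      unchanged a b b≢j = reflexive (≡.cong (λ t → if S b ∧ t then new a b else M a b)
                                      (below-suc b k (λ b≡k → b≢j (FP.toℕ-injective (≡.trans b≡k (≡.sym j≡k))))))
      -- the combination only involves columns outside S, which are never modified
      outside-S : ∀ a l → W l j * M a l ≈ W l j * done k a l
      outside-S a l with S l in Sl
      ... | true  = trans (*-congʳ (W-out l j Sl)) (trans (zeroˡ _) (sym (trans (*-congʳ (W-out l j Sl)) (zeroˡ _))))
      ... | false = refl
      changed : ∀ a → done (suc k) a j ≈ done k a j + sum (λ l → W l j * done k a l)
      changed a = begin
        done (suc k) a j
          ≡⟨ ≡.cong (if_then new a j else M a j)
               (≡.trans (≡.cong (_∧ below j (suc k)) Sj) (dec-true (toℕ j ℕ.<? suc k) (≡.subst (ℕ._< suc k) (≡.sym j≡k) (ℕP.n<1+n k)))) ⟩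
        M a j + sum (λ l → W l j * M a l)
          ≈⟨ +-cong (reflexive (≡.cong (if_then new a j else M a j)
                       (≡.sym (≡.trans (≡.cong (_∧ below j k) Sj) (dec-false (toℕ j ℕ.<? k) (ℕP.<-irrefl j≡k))))))
                    (sum-cong-≋ (outside-S a)) ⟩
        done k a j + sum (λ l → W l j * done k a l) ∎
    ... | false = det-cong≡ same
      where
      same : ∀ a b → done (suc k) a b ≡ done k a b
      same a b with b Fin.≟ j
      ... | yes ≡.refl rewrite Sj = ≡.refl
      ... | no b≢j = ≡.cong (λ t → if S b ∧ t then new a b else M a b)
                       (below-suc b k (λ b≡k → b≢j (FP.toℕ-injective (≡.trans b≡k (≡.sym j≡k)))))

    upto : ∀ k → k ℕ.≤ suc n → det R (done k) ≈ det R M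
    upto zero    _   = det-cong≡ (λ a j → ≡.cong (if_then new a j else M a j) (BP.∧-zeroʳ (S j)))
    upto (suc k) k<n = trans (step k (Fin.fromℕ< k<n) (FP.toℕ-fromℕ< k<n)) (upto k (ℕP.<⇒≤ k<n))

module Blocks {c ℓ : Level} (R : CommutativeRing c ℓ) where
  open CommutativeRing R hiding (zero)
  open Determinant R
  open ColumnOperations R
  open import Algebra.Properties.Ring ring using (-‿distribʳ-*)
  open IntegerSolver R using (solve; _:+_; _:*_; :-_; _:-_; _:=_)
  open import Relation.Binary.Reasoning.Setoid setoid

  private
    punchIn-↑ˡ : ∀ {p} q (a : Fin (suc p)) (b : Fin p) → punchIn (a ↑ˡ q) (b ↑ˡ q) ≡ punchIn a b ↑ˡ q
    punchIn-↑ˡ q zero    b       = ≡.refl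
    punchIn-↑ˡ q (suc a) zero    = ≡.refl
    punchIn-↑ˡ q (suc a) (suc b) = ≡.cong suc (punchIn-↑ˡ q a b)

    punchIn-↑ʳ : ∀ {p} q (a : Fin (suc p)) (b : Fin q) → punchIn (a ↑ˡ q) (p ↑ʳ b) ≡ suc p ↑ʳ b
    punchIn-↑ʳ q zero    b = ≡.refl
    punchIn-↑ʳ {suc p} q (suc a) b = ≡.cong suc (punchIn-↑ʳ q a b)

  det-block-triangular : ∀ p {q} (M : Matrix (p ℕ.+ q)) → (∀ a b → M (a ↑ˡ q) (p ↑ʳ b) ≈ 0#) →
    det R M ≈ det R (λ a b → M (a ↑ˡ q) (b ↑ˡ q)) * det R (λ a b → M (p ↑ʳ a) (p ↑ʳ b))
  det-block-triangular zero    M _ = sym (*-identityˡ _)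
  det-block-triangular (suc p) {q} M zero-block = begin
    det R M
      ≈⟨ det-row M ⟩
    sum T
      ≈⟨ sum-split (suc p) T ⟩
    sum (λ a → T (a ↑ˡ q)) + sum (λ b → T (suc p ↑ʳ b))
      ≈⟨ +-cong (sum-cong-≋ left-column) (sum-zero right-column) ⟩
    sum (λ a → sign a * A zero a * det R (minor zero a A) * det R D) + 0#
      ≈⟨ +-identityʳ _ ⟩
    sum (λ a → sign a * A zero a * det R (minor zero a A) * det R D)
      ≈⟨ *-distribʳ-sum (det R D) (λ a → sign a * A zero a * det R (minor zero a A)) ⟨
    sum (λ a → sign a * A zero a * det R (minor zero a A)) * det R D
      ≈⟨ *-congʳ (det-row A) ⟨
    det R A * det R D ∎
    where
    A : Matrix (suc p)
    A a b = M (a ↑ˡ q) (b ↑ˡ q)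
    D : Matrix q
    D a b = M (suc p ↑ʳ a) (suc p ↑ʳ b)
    T : Fin (suc (p ℕ.+ q)) → Carrier
    T j = sign j * M zero j * det R (minor zero j M)
    right-column : ∀ b → T (suc p ↑ʳ b) ≈ 0#
    right-column b = trans (*-congʳ (trans (*-congˡ (zero-block zero b)) (zeroʳ _))) (zeroˡ _)
    -- the minor of a first-row entry is again block lower triangular
    left-column : ∀ a → T (a ↑ˡ q) ≈ sign a * A zero a * det R (minor zero a A) * det R D
    left-column a = begin
      T (a ↑ˡ q)
        ≈⟨ *-cong (*-congʳ (reflexive (≡.cong (sgn R) (FP.toℕ-↑ˡ a q))))
                  (det-block-triangular p (minor zero (a ↑ˡ q) M) zero-block′) ⟩
      sign a * A zero a * (det R (λ x y → M (suc x ↑ˡ q) (punchIn (a ↑ˡ q) (y ↑ˡ q)))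
                            * det R (λ x y → M (suc p ↑ʳ x) (punchIn (a ↑ˡ q) (p ↑ʳ y))))
        ≈⟨ *-congˡ (*-cong (det-cong≡ (λ x y → ≡.cong (M (suc x ↑ˡ q)) (punchIn-↑ˡ q a y)))
                           (det-cong≡ (λ x y → ≡.cong (M (suc p ↑ʳ x)) (punchIn-↑ʳ q a y)))) ⟩
      sign a * A zero a * (det R (minor zero a A) * det R D)
        ≈⟨ *-assoc _ _ _ ⟨
      sign a * A zero a * det R (minor zero a A) * det R D ∎
      where
      zero-block′ : ∀ x y → minor zero (a ↑ˡ q) M (x ↑ˡ q) (p ↑ʳ y) ≈ 0#
      zero-block′ x y = trans (reflexive (≡.cong (M (suc x ↑ˡ q)) (punchIn-↑ʳ q a y))) (zero-block (suc x) y)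

  module Halves (N : ℕ) where
    data Half : Fin (N ℕ.+ N) → Set where
      left  : ∀ a → Half (a ↑ˡ N)
      right : ∀ b → Half (N ↑ʳ b)

    half : ∀ i → Half i
    half i with splitAt N i | FP.join-splitAt N N i
    ... | inj₁ a | ≡.refl = left a
    ... | inj₂ b | ≡.refl = right b

    -- column operations between the halves are instances of det-cols-add
    -- with S the left (resp. right) half
    isLeft : Fin (N ℕ.+ N) → Bool
    isLeft i = Sum.[ (λ _ → true) , (λ _ → false) ]′ (splitAt N i)

    isLeft-↑ˡ : ∀ a → isLeft (a ↑ˡ N) ≡ true
    isLeft-↑ˡ a = ≡.cong Sum.[ (λ _ → true) , (λ _ → false) ]′ (FP.splitAt-↑ˡ N a N)

    isLeft-↑ʳ : ∀ b → isLeft (N ↑ʳ b) ≡ false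
    isLeft-↑ʳ b = ≡.cong Sum.[ (λ _ → true) , (λ _ → false) ]′ (FP.splitAt-↑ʳ N N b)

    block : (A B C D : Matrix N) → Matrix (N ℕ.+ N)
    block A B C D i j with splitAt N i | splitAt N j
    ... | inj₁ a | inj₁ b = A a b
    ... | inj₁ a | inj₂ b = B a b
    ... | inj₂ a | inj₁ b = C a b
    ... | inj₂ a | inj₂ b = D a b

    module _ {A B C D : Matrix N} (a b : Fin N) where
      block-LL : block A B C D (a ↑ˡ N) (b ↑ˡ N) ≡ A a b
      block-LL rewrite FP.splitAt-↑ˡ N a N | FP.splitAt-↑ˡ N b N = ≡.refl
      block-LR : block A B C D (a ↑ˡ N) (N ↑ʳ b) ≡ B a b
      block-LR rewrite FP.splitAt-↑ˡ N a N | FP.splitAt-↑ʳ N N b = ≡.refl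
      block-RL : block A B C D (N ↑ʳ a) (b ↑ˡ N) ≡ C a b
      block-RL rewrite FP.splitAt-↑ʳ N N a | FP.splitAt-↑ˡ N b N = ≡.refl
      block-RR : block A B C D (N ↑ʳ a) (N ↑ʳ b) ≡ D a b
      block-RR rewrite FP.splitAt-↑ʳ N N a | FP.splitAt-↑ʳ N N b = ≡.refl

    O : Matrix N
    O _ _ = 0#

    −I : Matrix N
    −I a b = - I a b

    private
      true≢false : ∀ {x : Bool} → x ≡ true → x ≡ false → ∀ {p} {P : Set p} → P
      true≢false ≡.refl ()

    det-add-to-left : (M K : Matrix (N ℕ.+ N)) (Q : Matrix N) →
      (∀ i b → K i (N ↑ʳ b) ≈ M i (N ↑ʳ b)) →
      (∀ i b → K i (b ↑ˡ N) ≈ M i (b ↑ˡ N) + sum (λ l → Q l b * M i (N ↑ʳ l))) → det R K ≈ det R M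
    det-add-to-left M K Q K-right K-left = det-cols-add M K isLeft W W-zero unchanged changed
      where
      W : Matrix (N ℕ.+ N)
      W = block O O Q O
      W-zero : ∀ l j → isLeft l ≡ true → W l j ≈ 0#
      W-zero l j with half l | half j
      ... | left a  | left b  = λ _ → reflexive (block-LL a b)
      ... | left a  | right b = λ _ → reflexive (block-LR a b)
      ... | right a | _       = λ t → true≢false t (isLeft-↑ʳ a)
      unchanged : ∀ i j → isLeft j ≡ false → K i j ≈ M i j
      unchanged i j with half j
      ... | left b  = λ f → true≢false (isLeft-↑ˡ b) f
      ... | right b = λ _ → K-right i b
      changed : ∀ i j → isLeft j ≡ true → K i j ≈ M i j + sum (λ l → W l j * M i l)
      changed i j with half j
      ... | right b = λ t → true≢false t (isLeft-↑ʳ b)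
      ... | left b  = λ _ → trans (K-left i b) (+-congˡ (sym (begin
        sum (λ l → W l (b ↑ˡ N) * M i l)
          ≈⟨ sum-split N (λ l → W l (b ↑ˡ N) * M i l) ⟩
        sum (λ l → W (l ↑ˡ N) (b ↑ˡ N) * M i (l ↑ˡ N)) + sum (λ l → W (N ↑ʳ l) (b ↑ˡ N) * M i (N ↑ʳ l))
          ≈⟨ +-cong (sum-zero (λ l → trans (*-congʳ (reflexive (block-LL l b))) (zeroˡ _)))
                    (sum-cong-≋ (λ l → *-congʳ (reflexive (block-RL l b)))) ⟩
        0# + sum (λ l → Q l b * M i (N ↑ʳ l))
          ≈⟨ +-identityˡ _ ⟩
        sum (λ l → Q l b * M i (N ↑ʳ l)) ∎)))

    det-add-to-right : (M K : Matrix (N ℕ.+ N)) (Q : Matrix N) →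
      (∀ i b → K i (b ↑ˡ N) ≈ M i (b ↑ˡ N)) →
      (∀ i b → K i (N ↑ʳ b) ≈ M i (N ↑ʳ b) + sum (λ l → Q l b * M i (l ↑ˡ N))) → det R K ≈ det R M
    det-add-to-right M K Q K-left K-right = det-cols-add M K isRight W W-zero unchanged changed
      where
      isRight : Fin (N ℕ.+ N) → Bool
      isRight = not ∘ isLeft
      W : Matrix (N ℕ.+ N)
      W = block O Q O O
      W-zero : ∀ l j → isRight l ≡ true → W l j ≈ 0#
      W-zero l j with half l | half j
      ... | right a | left b  = λ _ → reflexive (block-RL a b)
      ... | right a | right b = λ _ → reflexive (block-RR a b)
      ... | left a  | _       = λ t → true≢false t (≡.cong not (isLeft-↑ˡ a))
      unchanged : ∀ i j → isRight j ≡ false → K i j ≈ M i j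
      unchanged i j with half j
      ... | right b = λ f → true≢false (≡.cong not (isLeft-↑ʳ b)) f
      ... | left b  = λ _ → K-left i b
      changed : ∀ i j → isRight j ≡ true → K i j ≈ M i j + sum (λ l → W l j * M i l)
      changed i j with half j
      ... | left b  = λ t → true≢false t (≡.cong not (isLeft-↑ˡ b))
      ... | right b = λ _ → trans (K-right i b) (+-congˡ (sym (begin
        sum (λ l → W l (N ↑ʳ b) * M i l)
          ≈⟨ sum-split N (λ l → W l (N ↑ʳ b) * M i l) ⟩
        sum (λ l → W (l ↑ˡ N) (N ↑ʳ b) * M i (l ↑ˡ N)) + sum (λ l → W (N ↑ʳ l) (N ↑ʳ b) * M i (N ↑ʳ l))
          ≈⟨ +-cong (sum-cong-≋ (λ l → *-congʳ (reflexive (block-LR l b))))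
                    (sum-zero (λ l → trans (*-congʳ (reflexive (block-RR l b))) (zeroˡ _))) ⟩
        sum (λ l → Q l b * M i (l ↑ˡ N)) + 0#
          ≈⟨ +-identityʳ _ ⟩
        sum (λ l → Q l b * M i (l ↑ˡ N)) ∎)))

    private
      schur-left : (A B C : Matrix N) →
        det R (block A −I C B) ≈ det R (block I −I (λ a b → C a b + sum (λ l → (A l b - I l b) * B a l)) B)
      schur-left A B C = sym (det-add-to-left M K Q K-right K-left)
        where
        M K : Matrix (N ℕ.+ N)
        M = block A −I C B
        Q : Matrix N
        Q a b = A a b - I a b
        K = block I −I (λ a b → C a b + sum (λ l → Q l b * B a l)) B
        K-right : ∀ i b → K i (N ↑ʳ b) ≈ M i (N ↑ʳ b)
        K-right i b with half i
        ... | left a  = reflexive (≡.trans (block-LR a b) (≡.sym (block-LR a b)))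
        ... | right a = reflexive (≡.trans (block-RR a b) (≡.sym (block-RR a b)))
        K-left : ∀ i b → K i (b ↑ˡ N) ≈ M i (b ↑ˡ N) + sum (λ l → Q l b * M i (N ↑ʳ l))
        K-left i b with half i
        ... | left a = begin
          K (a ↑ˡ N) (b ↑ˡ N)                              ≡⟨ block-LL a b ⟩
          I a b                                            ≈⟨ solve 2 (λ x y → y := x :+ :- (x :- y)) refl (A a b) (I a b) ⟩
          A a b + - Q a b                                  ≈⟨ +-congˡ (-‿cong (sum-I-right (λ l → Q l b) a)) ⟨
          A a b + - sum (λ l → Q l b * I a l)              ≈⟨ +-congˡ (sum-neg (λ l → Q l b * I a l)) ⟨
          A a b + sum (λ l → - (Q l b * I a l))            ≈⟨ +-cong (reflexive (≡.sym (block-LL a b)))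
                                                                (sum-cong-≋ (λ l → trans (-‿distribʳ-* (Q l b) (I a l))
                                                                   (*-congˡ (reflexive (≡.sym (block-LR {A} {−I} {C} {B} a l)))))) ⟩
          M (a ↑ˡ N) (b ↑ˡ N) + sum (λ l → Q l b * M (a ↑ˡ N) (N ↑ʳ l)) ∎
        ... | right a = begin
          K (N ↑ʳ a) (b ↑ˡ N)                              ≡⟨ block-RL a b ⟩
          C a b + sum (λ l → Q l b * B a l)                ≈⟨ +-cong (reflexive (≡.sym (block-RL a b)))
                                                                (sum-cong-≋ (λ l → *-congˡ (reflexive (≡.sym (block-RR {A} {−I} {C} {B} a l))))) ⟩
          M (N ↑ʳ a) (b ↑ˡ N) + sum (λ l → Q l b * M (N ↑ʳ a) (N ↑ʳ l)) ∎

      schur-right : (B Y : Matrix N) → det R (block I −I Y B) ≈ det R (block I O Y (λ a b → B a b + Y a b))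
      schur-right B Y = sym (det-add-to-right K₁ K₂ I K₂-left K₂-right)
        where
        K₁ K₂ : Matrix (N ℕ.+ N)
        K₁ = block I −I Y B
        K₂ = block I O Y (λ a b → B a b + Y a b)
        K₂-left : ∀ i b → K₂ i (b ↑ˡ N) ≈ K₁ i (b ↑ˡ N)
        K₂-left i b with half i
        ... | left a  = reflexive (≡.trans (block-LL a b) (≡.sym (block-LL a b)))
        ... | right a = reflexive (≡.trans (block-RL a b) (≡.sym (block-RL a b)))
        K₂-right : ∀ i b → K₂ i (N ↑ʳ b) ≈ K₁ i (N ↑ʳ b) + sum (λ l → I l b * K₁ i (l ↑ˡ N))
        K₂-right i b with half i
        ... | left a = begin
          K₂ (a ↑ˡ N) (N ↑ʳ b)                                ≡⟨ block-LR a b ⟩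
          0#                                                  ≈⟨ -‿inverseˡ (I a b) ⟨
          - I a b + I a b                                     ≈⟨ +-cong (reflexive (block-LR a b))
                                                                (trans (sum-cong-≋ (λ l → *-congˡ (reflexive (block-LL {I} {−I} {Y} {B} a l))))
                                                                       (sum-I-left (I a) b)) ⟨
          K₁ (a ↑ˡ N) (N ↑ʳ b) + sum (λ l → I l b * K₁ (a ↑ˡ N) (l ↑ˡ N)) ∎
        ... | right a = begin
          K₂ (N ↑ʳ a) (N ↑ʳ b)                                ≡⟨ block-RR a b ⟩
          B a b + Y a b                                       ≈⟨ +-cong (reflexive (≡.sym (block-RR a b)))
                                                                (trans (sym (sum-I-left (Y a) b))
                                                                       (sum-cong-≋ (λ l → *-congˡ (reflexive (≡.sym (block-RL {I} {−I} {Y} {B} a l)))))) ⟩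
          K₁ (N ↑ʳ a) (N ↑ʳ b) + sum (λ l → I l b * K₁ (N ↑ʳ a) (l ↑ˡ N)) ∎

    -- the Schur complement formula  det [[A, −I], [C, B]] = det (C + B A):
    -- two rounds of column operations lead to [[I, 0], [Y, B + Y]] with
    -- Y = C + B (A − I), which is block triangular
    det-schur : (A B C : Matrix N) →
      det R (block A −I C B) ≈ det R (λ a b → C a b + sum (λ l → B a l * A l b))
    det-schur A B C = begin
      det R (block A −I C B)                     ≈⟨ schur-left A B C ⟩
      det R (block I −I Y B)                     ≈⟨ schur-right B Y ⟩
      det R (block I O Y (λ a b → B a b + Y a b)) ≈⟨ det-block-triangular N _ (λ a b → reflexive (block-LR a b)) ⟩
      det R (λ a b → block I O Y B+Y (a ↑ˡ N) (b ↑ˡ N)) * det R (λ a b → block I O Y B+Y (N ↑ʳ a) (N ↑ʳ b))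
                                                 ≈⟨ *-cong (trans (det-cong≡ block-LL) (det-I {N})) (det-cong complement) ⟩
      1# * det R X                               ≈⟨ *-identityˡ _ ⟩
      det R X                                    ∎
      where
      Y X B+Y : Matrix N
      Y a b = C a b + sum (λ l → (A l b - I l b) * B a l)
      X a b = C a b + sum (λ l → B a l * A l b)
      B+Y a b = B a b + Y a b
      -- (A − I) B = B A − B, entrywise
      complement : ∀ a b → block I O Y B+Y (N ↑ʳ a) (N ↑ʳ b) ≈ X a b
      complement a b = begin
        block I O Y B+Y (N ↑ʳ a) (N ↑ʳ b)
          ≡⟨ block-RR a b ⟩
        B a b + (C a b + sum (λ l → (A l b - I l b) * B a l))
          ≈⟨ +-congˡ (+-congˡ (sum-cong-≋ (λ l → solve 3 (λ x y z → (x :- y) :* z := z :* x :+ :- (y :* z)) refl (A l b) (I l b) (B a l)))) ⟩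
        B a b + (C a b + sum (λ l → B a l * A l b + - (I l b * B a l)))
          ≈⟨ +-congˡ (+-congˡ (∑-distrib-+ (λ l → B a l * A l b) (λ l → - (I l b * B a l)))) ⟩
        B a b + (C a b + (sum (λ l → B a l * A l b) + sum (λ l → - (I l b * B a l))))
          ≈⟨ +-congˡ (+-congˡ (+-congˡ (trans (sum-neg (λ l → I l b * B a l)) (-‿cong (sum-I-left (B a) b))))) ⟩
        B a b + (C a b + (sum (λ l → B a l * A l b) - B a b))
          ≈⟨ solve 3 (λ b c s → b :+ (c :+ (s :- b)) := c :+ s) refl (B a b) (C a b) (sum (λ l → B a l * A l b)) ⟩
        X a b ∎

    -- the determinant is multiplicative: [[A, −I], [0, B]] is block triangular
    det-mul : (A B : Matrix N) → det R (λ a b → sum (λ l → B a l * A l b)) ≈ det R B * det R A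
    det-mul A B = begin
      det R (λ a b → sum (λ l → B a l * A l b))
        ≈⟨ det-cong (λ a b → +-identityˡ (sum (λ l → B a l * A l b))) ⟨
      det R (λ a b → O a b + sum (λ l → B a l * A l b))
        ≈⟨ det-schur A B O ⟨
      det R H
        ≈⟨ det-transpose H ⟨
      det R (transpose H)
        ≈⟨ det-block-triangular N (transpose H) (λ a b → reflexive (block-RL b a)) ⟩
      det R (λ a b → H (b ↑ˡ N) (a ↑ˡ N)) * det R (λ a b → H (N ↑ʳ b) (N ↑ʳ a))
        ≈⟨ *-cong (trans (det-cong≡ (λ a b → block-LL b a)) (det-transpose A))
                  (trans (det-cong≡ (λ a b → block-RR b a)) (det-transpose B)) ⟩
      det R A * det R B
        ≈⟨ *-comm _ _ ⟩
      det R B * det R A ∎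
      where H = block A −I O B

-- Removing leaves peels off factors α; for a bare cycle the determinant
-- is computed by expansion along the first row.

module FunctionalMatrix {c ℓ : Level} (R : CommutativeRing c ℓ) where
  open CommutativeRing R hiding (zero)
  open Determinant R
  open Permuting R
  open import Algebra.Properties.Ring ring using (-0#≈0#)
  open IntegerSolver R using (solve; _:+_; _:*_; :-_; _:-_; _:=_; :0; :1)
  open import Relation.Binary.Reasoning.Setoid setoid

  private
    _^_ : Carrier → ℕ → Carrier
    _^_ = pow R

  αI-βP : ∀ {N} → Carrier → Carrier → (Fin N → Fin N) → Matrix N
  αI-βP α β f a b = diagonal α a b - β * (if f a == b then 1# else 0#)

  module _ (α β : Carrier) where
    private
      if-same : ∀ b (x : Carrier) → (if b then x else x) ≡ x
      if-same true  x = ≡.refl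
      if-same false x = ≡.refl

      -- entries of the (m+1)×(m+1) matrix with α on the diagonal except a
      -- in the top left corner, −β on the superdiagonal and g in the
      -- bottom left corner
      entry : ℕ → Carrier → Carrier → ℕ → ℕ → Carrier
      entry m a g r s = (if r ≡ᵇ s then (if r ≡ᵇ 0 then a else α) else 0#)
                      + (if s ≡ᵇ suc r then - β else 0#)
                      + (if r ≡ᵇ m then (if s ≡ᵇ 0 then g else 0#) else 0#)

      cornered : ∀ m → Carrier → Carrier → Matrix (suc m)
      cornered m a g i j = entry m a g (toℕ i) (toℕ j)

      minor₀₀ : ∀ m a g r s → entry (suc m) a g (suc r) (suc s) ≈ entry m α 0# r s
      minor₀₀ m a g r s = +-cong (+-congʳ (reflexive (≡.cong (if r ≡ᵇ s then_else 0#) (≡.sym (if-same (r ≡ᵇ 0) α)))))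
        (reflexive (≡.trans (if-same (r ≡ᵇ m) 0#)
          (≡.sym (≡.trans (≡.cong (if r ≡ᵇ m then_else 0#) (if-same (s ≡ᵇ 0) 0#)) (if-same (r ≡ᵇ m) 0#)))))

      minor₀₁ : ∀ m a g r (y : Fin (suc m)) → entry (suc m) a g (suc r) (toℕ (punchIn (suc zero) y)) ≈ entry m 0# g r (toℕ y)
      minor₀₁ m a g zero    zero    = refl
      minor₀₁ m a g (suc r) zero    = refl
      minor₀₁ m a g zero    (suc y) = refl
      minor₀₁ m a g (suc r) (suc y) = refl

      det-cornered : ∀ m a g → det R (cornered m a g) ≈ a * α ^ m + β ^ m * g
      det-cornered zero a g = solve 2 (λ a g → :1 :* (a :+ :0 :+ g) :* :1 :+ :0 := a :* :1 :+ :1 :* g) refl a g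
      det-cornered (suc m) a g = begin
        det R (cornered (suc m) a g)
          ≈⟨ det-row (cornered (suc m) a g) ⟩
        T₀ + (T₁ + sum T₊)
          ≈⟨ +-cong (*-congˡ minor₀-det) (+-cong (*-congˡ minor₁-det) (sum-zero rest-zero)) ⟩
        1# * (a + 0# + 0#) * (α * α ^ m + β ^ m * 0#) + ((- 1#) * (0# + - β + 0#) * (0# * α ^ m + β ^ m * g) + 0#)
          ≈⟨ solve 6 (λ a g x y A B → :1 :* (a :+ :0 :+ :0) :* (x :* A :+ B :* :0) :+ ((:- :1) :* (:0 :+ :- y :+ :0) :* (:0 :* A :+ B :* g) :+ :0)
                                      := a :* (x :* A) :+ (y :* B) :* g) refl a g α β (α ^ m) (β ^ m) ⟩
        a * α ^ suc m + β ^ suc m * g ∎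
        where
        C : Matrix (suc (suc m))
        C = cornered (suc m) a g
        T₀ T₁ : Carrier
        T₀ = sign {suc (suc m)} zero * C zero zero * det R (minor zero zero C)
        T₁ = sign {suc (suc m)} (suc zero) * C zero (suc zero) * det R (minor zero (suc zero) C)
        T₊ : Fin m → Carrier
        T₊ j = sign (suc (suc j)) * C zero (suc (suc j)) * det R (minor zero (suc (suc j)) C)
        minor₀-det : det R (minor zero zero C) ≈ α * α ^ m + β ^ m * 0#
        minor₀-det = trans (det-cong {suc m} (λ x y → minor₀₀ m a g (toℕ x) (toℕ y))) (det-cornered m α 0#)
        minor₁-det : det R (minor zero (suc zero) C) ≈ 0# * α ^ m + β ^ m * g
        minor₁-det = trans (det-cong {suc m} (λ x y → minor₀₁ m a g (toℕ x) y)) (det-cornered m 0# g)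
        rest-zero : ∀ j → T₊ j ≈ 0#
        rest-zero j = begin
          sign (suc (suc j)) * (0# + 0# + 0#) * d ≈⟨ *-congʳ (*-congˡ (trans (+-identityʳ _) (+-identityʳ 0#))) ⟩
          sign (suc (suc j)) * 0# * d              ≈⟨ *-congʳ (zeroʳ _) ⟩
          0# * d                                  ≈⟨ zeroˡ d ⟩
          0#                                      ∎
          where d = det R (minor zero (suc (suc j)) C)

      ≡ᵇ-true : ∀ {m n} → m ≡ n → (m ≡ᵇ n) ≡ true
      ≡ᵇ-true {m} {n} m≡n with m ≡ᵇ n in e
      ... | true  = ≡.refl
      ... | false = ⊥-elim (≡.subst Bool.T e (ℕP.≡⇒≡ᵇ m n m≡n))

      ≡ᵇ-false : ∀ {m n} → m ≢ n → (m ≡ᵇ n) ≡ false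
      ≡ᵇ-false {m} {n} m≢n with m ≡ᵇ n in e
      ... | true  = ⊥-elim (m≢n (ℕP.≡ᵇ⇒≡ m n (≡.subst Bool.T (≡.sym e) _)))
      ... | false = ≡.refl

      ≡ᵇ-sym : ∀ m n → (m ≡ᵇ n) ≡ (n ≡ᵇ m)
      ≡ᵇ-sym zero    zero    = ≡.refl
      ≡ᵇ-sym zero    (suc n) = ≡.refl
      ≡ᵇ-sym (suc m) zero    = ≡.refl
      ≡ᵇ-sym (suc m) (suc n) = ≡ᵇ-sym m n

      ==-toℕ : ∀ {k} (a b : Fin k) → (a == b) ≡ (toℕ a ≡ᵇ toℕ b)
      ==-toℕ a b with a Fin.≟ b
      ... | yes ≡.refl = ≡.sym (≡ᵇ-true {toℕ a} ≡.refl)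
      ... | no a≢b     = ≡.sym (≡ᵇ-false (a≢b ∘ FP.toℕ-injective))

      -β·[_] : ∀ x → - (β * (if x then 1# else 0#)) ≈ (if x then - β else 0#)
      -β·[ true  ] = -‿cong (*-identityʳ β)
      -β·[ false ] = trans (-‿cong (zeroʳ β)) -0#≈0#

      diag-α : ∀ d w → (if d then α else 0#) ≡ (if d then (if w then α else α) else 0#)
      diag-α d w = ≡.cong (if d then_else 0#) (≡.sym (if-same w α))

      -- the cycle, numbered along itself, in row a: −β in the column after a,
      -- which is the superdiagonal except in the last row
      cycle-matrix : ∀ m (a b : Fin (suc m)) → αI-βP α β next a b ≈ cornered m α (- β) a b
      cycle-matrix m a b with next-follows a
      ... | inj₁ next≡a+1 = begin
        (if a == b then α else 0#) - β * (if next a == b then 1# else 0#)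
          ≡⟨ ≡.cong₂ (λ d x → (if d then α else 0#) - β * (if x then 1# else 0#)) (==-toℕ a b)
               (≡.trans (==-toℕ (next a) b) (≡.trans (≡.cong (_≡ᵇ toℕ b) next≡a+1) (≡ᵇ-sym (suc (toℕ a)) (toℕ b)))) ⟩
        (if d then α else 0#) - β * (if y then 1# else 0#)
          ≈⟨ +-cong (reflexive (diag-α d (toℕ a ≡ᵇ 0))) -β·[ y ] ⟩
        (if d then (if toℕ a ≡ᵇ 0 then α else α) else 0#) + (if y then - β else 0#)
          ≈⟨ +-identityʳ _ ⟨
        (if d then (if toℕ a ≡ᵇ 0 then α else α) else 0#) + (if y then - β else 0#) + 0#
          ≡⟨ ≡.cong (λ z → (if d then (if toℕ a ≡ᵇ 0 then α else α) else 0#) + (if y then - β else 0#)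
                            + (if z then (if toℕ b ≡ᵇ 0 then - β else 0#) else 0#)) (≡.sym (≡ᵇ-false a≢m)) ⟩
        cornered m α (- β) a b ∎
        where
        d = toℕ a ≡ᵇ toℕ b
        y = toℕ b ≡ᵇ suc (toℕ a)
        a≢m : toℕ a ≢ m
        a≢m a≡m = ℕP.<-irrefl ≡.refl (≡.subst (ℕ._< suc m) (≡.trans next≡a+1 (≡.cong suc a≡m)) (FP.toℕ<n (next a)))
      ... | inj₂ (next≡0 , a+1≡k) = begin
        (if a == b then α else 0#) - β * (if next a == b then 1# else 0#)
          ≡⟨ ≡.cong₂ (λ d x → (if d then α else 0#) - β * (if x then 1# else 0#)) (==-toℕ a b)
               (≡.trans (==-toℕ (next a) b) (≡.trans (≡.cong (_≡ᵇ toℕ b) next≡0) (≡ᵇ-sym 0 (toℕ b)))) ⟩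
        (if d then α else 0#) - β * (if u then 1# else 0#)
          ≈⟨ +-cong (reflexive (diag-α d (toℕ a ≡ᵇ 0))) -β·[ u ] ⟩
        (if d then (if toℕ a ≡ᵇ 0 then α else α) else 0#) + (if u then - β else 0#)
          ≈⟨ +-congʳ (+-identityʳ _) ⟨
        (if d then (if toℕ a ≡ᵇ 0 then α else α) else 0#) + 0# + (if u then - β else 0#)
          ≡⟨ ≡.cong₂ (λ y z → (if d then (if toℕ a ≡ᵇ 0 then α else α) else 0#) + (if y then - β else 0#)
                               + (if z then (if u then - β else 0#) else 0#))
                     (≡.sym (≡ᵇ-false b≢a+1)) (≡.sym (≡ᵇ-true (ℕP.suc-injective a+1≡k))) ⟩
        cornered m α (- β) a b ∎
        where
        d = toℕ a ≡ᵇ toℕ b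
        u = toℕ b ≡ᵇ 0
        b≢a+1 : toℕ b ≢ suc (toℕ a)
        b≢a+1 b≡a+1 = ℕP.<-irrefl ≡.refl (≡.subst (ℕ._< suc m) (≡.trans b≡a+1 a+1≡k) (FP.toℕ<n b))

    det-cycle : ∀ m → det R (αI-βP α β (next {suc m})) ≈ α ^ suc m - β ^ suc m
    det-cycle m = begin
      det R (αI-βP α β (next {suc m}))  ≈⟨ det-cong (cycle-matrix m) ⟩
      det R (cornered m α (- β))        ≈⟨ det-cornered m α (- β) ⟩
      α * α ^ m + β ^ m * (- β)         ≈⟨ solve 4 (λ a b A B → a :* A :+ B :* (:- b) := a :* A :- b :* B) refl α β (α ^ m) (β ^ m) ⟩
      α ^ suc m - β ^ suc m             ∎

    private
      -- when the cycle is everything, number the points along the cycle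
      det-bare-cycle : ∀ {N} {f : Fin N → Fin N} → Unicyclic f N → det R (αI-βP α β f) ≈ α ^ N - β ^ N
      det-bare-cycle {suc m} {f} U = begin
        det R (αI-βP α β f)                          ≈⟨ det-relabel-injective ≡.refl (αI-βP α β f) cyc cyc-inj ⟨
        det R (λ a b → αI-βP α β f (cyc a) (cyc b))  ≈⟨ det-cong≡ along-cycle ⟩
        det R (αI-βP α β (next {suc m}))             ≈⟨ det-cycle m ⟩
        α ^ suc m - β ^ suc m                        ∎
        where
        open Unicyclic U
        along-cycle : ∀ a b → αI-βP α β f (cyc a) (cyc b) ≡ αI-βP α β next a b
        along-cycle a b = ≡.cong₂ (λ d x → (if d then α else 0#) - β * (if x then 1# else 0#))
          (==-injective cyc cyc-inj a b)
          (≡.trans (≡.cong (_== cyc b) (cyc-closed a)) (==-injective cyc cyc-inj (next a) b))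

      -- a leaf x contributes a factor α: its column is α at x and 0 elsewhere
      det-remove-leaf : ∀ {N′ k} {f : Fin (suc N′) → Fin (suc N′)} (U : Unicyclic f k) x (lf : ∀ y → f y ≢ x) →
        det R (αI-βP α β f) ≈ α * det R (αI-βP α β (RemoveLeaf.f′ U x lf))
      det-remove-leaf {f = f} U x lf = begin
        det R (αI-βP α β f)                                ≈⟨ det-col-diagonal (αI-βP α β f) x column-x ⟩
        αI-βP α β f x x * det R (minor x x (αI-βP α β f))  ≈⟨ *-cong diagonal-x (det-cong≡ minor-x) ⟩
        α * det R (αI-βP α β f′)                           ∎
        where
        open RemoveLeaf U x lf
        no-arc : ∀ r → - (β * (if f r == x then 1# else 0#)) ≈ 0#
        no-arc r = trans (-‿cong (trans (*-congˡ (reflexive (≡.cong (if_then 1# else 0#) (==-≢ (lf r))))) (zeroʳ β))) -0#≈0#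
        column-x : ∀ r → r ≢ x → αI-βP α β f r x ≈ 0#
        column-x r r≢x = trans (+-cong (reflexive (≡.cong (if_then α else 0#) (==-≢ r≢x))) (no-arc r)) (+-identityʳ 0#)
        diagonal-x : αI-βP α β f x x ≈ α
        diagonal-x = trans (+-cong (reflexive (≡.cong (if_then α else 0#) (==-refl x))) (no-arc x)) (+-identityʳ α)
        minor-x : ∀ a b → αI-βP α β f (punchIn x a) (punchIn x b) ≡ αI-βP α β f′ a b
        minor-x a b = ≡.cong₂ (λ d y → (if d then α else 0#) - β * (if y then 1# else 0#))
          (==-injective (punchIn x) (FP.punchIn-injective x _ _) a b)
          (≡.trans (≡.cong (_== punchIn x b) (≡.sym (punchIn-f′ a)))
                   (==-injective (punchIn x) (FP.punchIn-injective x _ _) (f′ a) b))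

    -- by induction on N: while the cycle is shorter than N, remove a leaf
    det-unicyclic : ∀ {N k} {f : Fin N → Fin N} → Unicyclic f k → det R (αI-βP α β f) ≈ α ^ (N ℕ.∸ k) * (α ^ k - β ^ k)
    det-unicyclic {zero} U = ⊥-elim (FP.¬Fin0 (Unicyclic.cyc U (Fin.fromℕ< (Unicyclic.cyc-nonempty U))))
    det-unicyclic {suc N′} {k} {f} U with k ℕ.<? suc N′
    ... | no k≮N = begin
      det R (αI-βP α β f)                   ≈⟨ det-bare-cycle (≡.subst (Unicyclic f) k≡N U) ⟩
      α ^ suc N′ - β ^ suc N′               ≡⟨ ≡.cong (λ j → α ^ j - β ^ j) k≡N ⟨
      α ^ k - β ^ k                         ≈⟨ *-identityˡ _ ⟨
      1# * (α ^ k - β ^ k)                  ≡⟨ ≡.cong (λ j → α ^ j * (α ^ k - β ^ k))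
                                                 (≡.trans (≡.cong (suc N′ ℕ.∸_) k≡N) (ℕP.n∸n≡0 (suc N′))) ⟨
      α ^ (suc N′ ℕ.∸ k) * (α ^ k - β ^ k)  ∎
      where
      k≡N : k ≡ suc N′
      k≡N = ℕP.≤-antisym (FP.injective⇒≤ (Unicyclic.cyc-inj U)) (ℕP.≮⇒≥ k≮N)
    ... | yes k<N = begin
      det R (αI-βP α β f)                     ≈⟨ det-remove-leaf U x lf ⟩
      α * det R (αI-βP α β f′)                ≈⟨ *-congˡ (det-unicyclic unicyclic′) ⟩
      α * (α ^ (N′ ℕ.∸ k) * (α ^ k - β ^ k))  ≈⟨ *-assoc _ _ _ ⟨
      α ^ suc (N′ ℕ.∸ k) * (α ^ k - β ^ k)    ≡⟨ ≡.cong (λ j → α ^ j * (α ^ k - β ^ k)) (ℕP.+-∸-assoc 1 (ℕ.s≤s⁻¹ k<N)) ⟨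
      α ^ (suc N′ ℕ.∸ k) * (α ^ k - β ^ k)    ∎
      where
      x  = proj₁ (UnicyclicProperties.leaf U k<N)
      lf = proj₂ (UnicyclicProperties.leaf U k<N)
      open RemoveLeaf U x lf

-- For a map
-- f with adjacency matrix P, write L(α, β) = α I − β P.  The matrix
-- t I − A of each derived digraph will turn out to be
--     [[L(t, u_F), −I], [L(0, 1), L(t, u_L)]]
-- (u_F, u_L = 1 when the arcs of F, resp. of F^l, are present), whose
-- Schur complement L(0, 1) + L(t, u_L) L(t, u_F) expands to
--     t² I − (t u_F + u_L t + 1) P + u_L u_F P².

module SchurComplement {c ℓ : Level} (R : CommutativeRing c ℓ) {N : ℕ} (f : Fin N → Fin N) where
  open CommutativeRing R hiding (zero)
  open Determinant R
  open FunctionalMatrix R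
  open IntegerSolver R using (solve; _:+_; _:*_; :-_; _:-_; _:=_; :0; :1)
  open import Relation.Binary.Reasoning.Setoid setoid

  L : Carrier → Carrier → Matrix N
  L α β = αI-βP α β f

  P P² : Matrix N
  P a b = if f a == b then 1# else 0#
  P² a b = sum (λ l → P a l * P l b)

  X : Bool → Bool → Carrier → Matrix N
  X uF uL t a b = L 0# 1# a b + sum (λ l → L t (bool01 R uL) a l * L t (bool01 R uF) l b)

  private
    diagonal≈ : ∀ α (a b : Fin N) → diagonal α a b ≈ α * I a b
    diagonal≈ α a b with a == b
    ... | true  = sym (*-identityʳ α)
    ... | false = sym (zeroʳ α)

    L≈ : ∀ α β a b → L α β a b ≈ α * I a b - β * P a b
    L≈ α β a b = +-congʳ (diagonal≈ α a b)

  L-product : ∀ x y z w a b → sum (λ l → L x y a l * L z w l b)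
    ≈ (x * z) * I a b - (x * w + y * z) * P a b + (y * w) * P² a b
  L-product x y z w a b = begin
    sum (λ l → L x y a l * L z w l b)
      ≈⟨ sum-cong-≋ (λ l → trans (*-cong (L≈ x y a l) (L≈ z w l b))
           (solve 8 (λ x y z w i p j q → (x :* i :- y :* p) :* (z :* j :- w :* q)
                     := (x :* z) :* (j :* i) :+ ((:- (x :* w)) :* (q :* i) :+ ((:- (y :* z)) :* (j :* p) :+ (y :* w) :* (p :* q))))
                  refl x y z w (I a l) (P a l) (I l b) (P l b))) ⟩
    sum (λ l → t₁ l + (t₂ l + (t₃ l + t₄ l)))
      ≈⟨ trans (∑-distrib-+ t₁ (λ l → t₂ l + (t₃ l + t₄ l))) (+-congˡ (trans (∑-distrib-+ t₂ (λ l → t₃ l + t₄ l)) (+-congˡ (∑-distrib-+ t₃ t₄)))) ⟩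
    sum t₁ + (sum t₂ + (sum t₃ + sum t₄))
      ≈⟨ +-cong (factor (x * z) (sum-I-left (I a) b))
                (+-cong (factor (- (x * w)) (sum-I-right (λ l → P l b) a))
                        (+-cong (factor (- (y * z)) (sum-I-left (P a) b)) (factor (y * w) refl))) ⟩
    (x * z) * I a b + ((- (x * w)) * P a b + ((- (y * z)) * P a b + (y * w) * P² a b))
      ≈⟨ solve 7 (λ xz xw yz yw i p q → xz :* i :+ ((:- xw) :* p :+ ((:- yz) :* p :+ yw :* q)) := xz :* i :- (xw :+ yz) :* p :+ yw :* q)
               refl (x * z) (x * w) (y * z) (y * w) (I a b) (P a b) (P² a b) ⟩
    (x * z) * I a b - (x * w + y * z) * P a b + (y * w) * P² a b ∎
    where
    t₁ t₂ t₃ t₄ : Fin N → Carrier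
    t₁ l = (x * z) * (I l b * I a l)
    t₂ l = (- (x * w)) * (P l b * I a l)
    t₃ l = (- (y * z)) * (I l b * P a l)
    t₄ l = (y * w) * (P a l * P l b)
    factor : ∀ κ {g : Fin N → Carrier} {v} → sum g ≈ v → sum (λ l → κ * g l) ≈ κ * v
    factor κ {g} Σg≈v = trans (sym (*-distribˡ-sum κ g)) (*-congˡ Σg≈v)

  X-expand : ∀ uF uL t a b → X uF uL t a b ≈
    (t * t) * I a b - (t * bool01 R uF + bool01 R uL * t + 1#) * P a b + (bool01 R uL * bool01 R uF) * P² a b
  X-expand uF uL t a b = begin
    L 0# 1# a b + sum (λ l → L t v a l * L t u l b)
      ≈⟨ +-cong (L≈ 0# 1# a b) (L-product t v t u a b) ⟩
    (0# * I a b - 1# * P a b) + ((t * t) * I a b - (t * u + v * t) * P a b + (v * u) * P² a b)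
      ≈⟨ solve 7 (λ t u v i p q w → (:0 :* i :- :1 :* p) :+ ((t :* t) :* i :- (t :* u :+ v :* t) :* p :+ w :* q)
                                    := (t :* t) :* i :- (t :* u :+ v :* t :+ :1) :* p :+ w :* q)
                 refl t u v (I a b) (P a b) (P² a b) (v * u) ⟩
    (t * t) * I a b - (t * u + v * t + 1#) * P a b + (v * u) * P² a b ∎
    where
    u = bool01 R uF
    v = bool01 R uL

  X-F00+ : ∀ t a b → X false false t a b ≈ L (t * t) 1# a b
  X-F00+ t a b = trans (X-expand false false t a b) (trans
    (solve 4 (λ t i p q → (t :* t) :* i :- (t :* :0 :+ :0 :* t :+ :1) :* p :+ (:0 :* :0) :* q := (t :* t) :* i :- :1 :* p)
           refl t (I a b) (P a b) (P² a b))
    (sym (L≈ (t * t) 1# a b)))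

  X-F+0+ : ∀ t a b → X true false t a b ≈ L (t * t) (t + 1#) a b
  X-F+0+ t a b = trans (X-expand true false t a b) (trans
    (solve 4 (λ t i p q → (t :* t) :* i :- (t :* :1 :+ :0 :* t :+ :1) :* p :+ (:0 :* :1) :* q := (t :* t) :* i :- (t :+ :1) :* p)
           refl t (I a b) (P a b) (P² a b))
    (sym (L≈ (t * t) (t + 1#) a b)))

  X-F0++ : ∀ t a b → X false true t a b ≈ L (t * t) (t + 1#) a b
  X-F0++ t a b = trans (X-expand false true t a b) (trans
    (solve 4 (λ t i p q → (t :* t) :* i :- (t :* :0 :+ :1 :* t :+ :1) :* p :+ (:1 :* :0) :* q := (t :* t) :* i :- (t :+ :1) :* p)
           refl t (I a b) (P a b) (P² a b))
    (sym (L≈ (t * t) (t + 1#) a b)))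

  -- with both, it factors as L(x₂, 1) L(x₁, 1) where x₁, x₂ are the roots of x² − (2t+1) x + t²
  X-F+++ : ∀ t x₁ x₂ → x₁ + x₂ ≈ (t + t) + 1# → x₁ * x₂ ≈ t * t →
    ∀ a b → X true true t a b ≈ sum (λ l → L x₂ 1# a l * L x₁ 1# l b)
  X-F+++ t x₁ x₂ sum≈ prod≈ a b = begin
    X true true t a b
      ≈⟨ X-expand true true t a b ⟩
    (t * t) * I a b - (t * 1# + 1# * t + 1#) * P a b + (1# * 1#) * P² a b
      ≈⟨ +-congʳ (+-cong (*-congʳ (sym (trans (*-comm x₂ x₁) prod≈))) (-‿cong (*-congʳ coefficient))) ⟩
    (x₂ * x₁) * I a b - (x₂ * 1# + 1# * x₁) * P a b + (1# * 1#) * P² a b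
      ≈⟨ L-product x₂ 1# x₁ 1# a b ⟨
    sum (λ l → L x₂ 1# a l * L x₁ 1# l b) ∎
    where
    coefficient : t * 1# + 1# * t + 1# ≈ x₂ * 1# + 1# * x₁
    coefficient = begin
      t * 1# + 1# * t + 1#  ≈⟨ solve 1 (λ t → t :* :1 :+ :1 :* t :+ :1 := (t :+ t) :+ :1) refl t ⟩
      (t + t) + 1#          ≈⟨ sum≈ ⟨
      x₁ + x₂               ≈⟨ solve 2 (λ a b → a :+ b := b :* :1 :+ :1 :* a) refl x₁ x₂ ⟩
      x₂ * 1# + 1# * x₁     ∎

module CharacteristicPolynomials {c ℓ : Level} (R : CommutativeRing c ℓ) where
  open CommutativeRing R hiding (zero)
  open Determinant R
  open Permuting R
  open Blocks R
  open import Relation.Binary.Reasoning.Setoid setoid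

  -- reversing all arcs transposes the matrix t I − A
  charPoly-converse : (G : Digraph) (a : Fin (size G) → Fin (size G) → Bool) → (∀ i j → a i j ≡ adj G j i) →
    ∀ t → charPoly R (record { size = size G ; adj = a }) t ≈ charPoly R G t
  charPoly-converse G a a≡adjᵀ t = trans
    (det-cong≡ (λ i j → ≡.cong₂ (λ d x → (if d then t else 0#) - bool01 R x) (==-sym i j) (a≡adjᵀ i j)))
    (det-transpose (λ i j → (if i == j then t else 0#) - bool01 R (adj G i j)))

  module FunctionCase (F : ArcDigraph) (f : Fin (n F) → Fin (n F))
                      (arc⇔ : ∀ x y → IsArc F x y ⇔ (y ≡ f x)) where
    open FunctionDigraph F f arc⇔
    open SchurComplement R f
    open Halves N

    private
      b01-if : ∀ x → bool01 R x ≈ 1# * (if x then 1# else 0#)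
      b01-if true  = sym (*-identityˡ 1#)
      b01-if false = sym (*-identityˡ 0#)

      b01-∧ : ∀ u x → bool01 R (u ∧ x) ≈ bool01 R u * (if x then 1# else 0#)
      b01-∧ true  x = b01-if x
      b01-∧ false x = sym (zeroˡ _)

    charPoly-F : ∀ s → charPoly R (underlying F) s ≈ det R (L s 1#)
    charPoly-F s = det-cong (λ i j → +-congˡ (-‿cong (trans (reflexive (≡.cong (bool01 R) (arc?-f i j))) (b01-if (f i == j)))))

    -- t I − A in block form, after numbering the arcs by their tails
    charPoly-blocks : ∀ uF uL t → charPoly R (total uF uL F) t ≈
      det R (block (L t (bool01 R uF)) −I (L 0# 1#) (L t (bool01 R uL)))
    charPoly-blocks uF uL t = begin
      det R CP                          ≈⟨ det-relabel-injective (≡.cong (N ℕ.+_) (≡.sym m≡N)) CP κ κ-inj ⟨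
      det R (λ i j → CP (κ i) (κ j))    ≈⟨ det-cong blocks ⟩
      det R (block A −I C B)            ∎
      where
      CP : Matrix (N ℕ.+ m F)
      CP i j = (if i == j then t else 0#) - bool01 R (Digraph.adj (total uF uL F) i j)
      A B C : Matrix N
      A = L t (bool01 R uF)
      B = L t (bool01 R uL)
      C = L 0# 1#
      ==-κ : ∀ i j → (κ i == κ j) ≡ (i == j)
      ==-κ = ==-injective κ κ-inj
      ==-↑ˡ : ∀ a b → ((a ↑ˡ N) == (b ↑ˡ N)) ≡ (a == b)
      ==-↑ˡ = ==-injective (_↑ˡ N) (FP.↑ˡ-injective N _ _)
      ==-↑ʳ : ∀ a b → ((N ↑ʳ a) == (N ↑ʳ b)) ≡ (a == b)
      ==-↑ʳ = ==-injective (N ↑ʳ_) (FP.↑ʳ-injective N _ _)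
      ==-↑ˡʳ : ∀ a b → ((a ↑ˡ N) == (N ↑ʳ b)) ≡ false
      ==-↑ˡʳ a b = ==-≢ (↑ˡ≢↑ʳ a b)
      entry : ∀ {i j} d x → (i == j) ≡ d → Digraph.adj (total uF uL F) (κ i) (κ j) ≡ x →
        CP (κ i) (κ j) ≡ (if d then t else 0#) - bool01 R x
      entry {i} {j} d x i==j adj≡ = ≡.cong₂ (λ d x → (if d then t else 0#) - bool01 R x) (≡.trans (==-κ i j) i==j) adj≡
      blocks : ∀ i j → CP (κ i) (κ j) ≈ block A −I C B i j
      blocks i j with half i | half j
      ... | left a | left b = begin
        CP (κ (a ↑ˡ N)) (κ (b ↑ˡ N))                          ≡⟨ entry _ _ (==-↑ˡ a b) (adj-LL uF uL a b) ⟩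
        (if a == b then t else 0#) - bool01 R (uF ∧ (f a == b)) ≈⟨ +-congˡ (-‿cong (b01-∧ uF (f a == b))) ⟩
        A a b                                                  ≡⟨ block-LL a b ⟨
        block A −I C B (a ↑ˡ N) (b ↑ˡ N)                      ∎
      ... | left a | right b = begin
        CP (κ (a ↑ˡ N)) (κ (N ↑ʳ b))                          ≡⟨ entry _ _ (==-↑ˡʳ a b) (≡.trans (adj-LR uF uL a b) (==-sym b a)) ⟩
        0# - bool01 R (a == b)                                 ≈⟨ trans (+-identityˡ _) (-‿cong (trans (b01-if (a == b)) (*-identityˡ _))) ⟩
        - I a b                                                ≡⟨ block-LR a b ⟨
        block A −I C B (a ↑ˡ N) (N ↑ʳ b)                      ∎
      ... | right a | left b = begin
        CP (κ (N ↑ʳ a)) (κ (b ↑ˡ N))                          ≡⟨ entry _ _ (≡.trans (==-sym (N ↑ʳ a) (b ↑ˡ N)) (==-↑ˡʳ b a)) (adj-RL uF uL a b) ⟩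
        0# - bool01 R (f a == b)                               ≡⟨ ≡.cong (λ z → z - bool01 R (f a == b)) (if-0 (a == b)) ⟩
        (if a == b then 0# else 0#) - bool01 R (f a == b)     ≈⟨ +-congˡ (-‿cong (b01-if (f a == b))) ⟩
        C a b                                                  ≡⟨ block-RL a b ⟨
        block A −I C B (N ↑ʳ a) (b ↑ˡ N)                      ∎
        where
        if-0 : ∀ d → 0# ≡ (if d then 0# else 0#)
        if-0 true  = ≡.refl
        if-0 false = ≡.refl
      ... | right a | right b = begin
        CP (κ (N ↑ʳ a)) (κ (N ↑ʳ b))                          ≡⟨ entry _ _ (==-↑ʳ a b) (adj-RR uF uL a b) ⟩
        (if a == b then t else 0#) - bool01 R (uL ∧ (f a == b)) ≈⟨ +-congˡ (-‿cong (b01-∧ uL (f a == b))) ⟩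
        B a b                                                  ≡⟨ block-RR a b ⟨
        block A −I C B (N ↑ʳ a) (N ↑ʳ b)                      ∎

    charPoly-derived : ∀ uF uL t → charPoly R (total uF uL F) t ≈ det R (X uF uL t)
    charPoly-derived uF uL t = trans (charPoly-blocks uF uL t) (det-schur (L t (bool01 R uF)) (L t (bool01 R uL)) (L 0# 1#))

module Spectra {c ℓ : Level} (R : CommutativeRing c ℓ) where
  open CommutativeRing R hiding (zero)
  open Determinant R
  open CharacteristicPolynomials R

  record Spectral (F : ArcDigraph) (k : ℕ) : Set (c ⊔ ℓ) where
    field
      f                : Fin (n F) → Fin (n F)
      unicyclic        : Unicyclic f k
      charPoly-F       : ∀ s → charPoly R (underlying F) s ≈ det R (SchurComplement.L R f s 1#)
      charPoly-derived : ∀ uF uL t → charPoly R (total uF uL F) t ≈ det R (SchurComplement.X R f uF uL t)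

  spectral-function : ∀ {F k} → Connected F → IsDigraphFunction F → HasDirectedCycle F k → Spectral F k
  spectral-function {F} conn (f , arc⇔) cycle = record
    { f = f
    ; unicyclic = FunctionDigraph.unicyclic F f arc⇔ conn cycle
    ; charPoly-F = FunctionCase.charPoly-F F f arc⇔
    ; charPoly-derived = FunctionCase.charPoly-derived F f arc⇔ }

  spectral-reverse : ∀ {F k} → Spectral (reverse F) k → Spectral F k
  spectral-reverse {F} S = record
    { f = f
    ; unicyclic = unicyclic
    ; charPoly-F = λ s → trans (sym (charPoly-converse (underlying F) (arc? (reverse F)) (reverse-arc? {F}) s)) (charPoly-F s)
    ; charPoly-derived = λ uF uL t →
        trans (sym (charPoly-converse (total uF uL F) (Digraph.adj (total uF uL (reverse F))) (reverse-total {F} uF uL) t))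
              (charPoly-derived uF uL t) }
    where open Spectral S

  spectral : ∀ {F k} → Connected F → (IsDigraphFunction F ⊎ IsInverseDigraphFunction F) →
    HasDirectedCycle F k → Spectral F k
  spectral conn (inj₁ fun) cycle = spectral-function conn fun cycle
  spectral {F} conn (inj₂ inv) cycle =
    spectral-reverse (spectral-function (reverse-connected conn) (reverse-function {F} inv) (reverse-cycle {F} cycle))

  module Consequences {F : ArcDigraph} {k : ℕ} (S : Spectral F k) where
    open Spectral S
    open SchurComplement R f
    open Powers R
    open Blocks.Halves R (n F) using (det-mul)
    open IntegerSolver R using (solve; _:*_; _:-_; _:=_; :1)
    open import Relation.Binary.Reasoning.Setoid setoid

    N d : ℕ
    N = n F
    d = N ℕ.∸ k

    private
      _^_ : Carrier → ℕ → Carrier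
      _^_ = pow R

      A : Digraph → Carrier → Carrier
      A = charPoly R

    det-L : ∀ α β → det R (L α β) ≈ α ^ d * (α ^ k - β ^ k)
    det-L α β = FunctionalMatrix.det-unicyclic R α β unicyclic

    charPoly-F+0+ : ∀ t → A (F+0+ F) t ≈ det R (L (t * t) (t + 1#))
    charPoly-F+0+ t = trans (charPoly-derived true false t) (det-cong (X-F+0+ t))

    a1 : ∀ t → (A (F00+ F) t ≈ A (underlying F) (t * t))
             × (A (underlying F) (t * t) ≈ (t ^ (2 ℕ.* d)) * ((t ^ (2 ℕ.* k)) - 1#))
    a1 t = trans (charPoly-derived false false t) (trans (det-cong (X-F00+ t)) (sym (charPoly-F (t * t))))
         , (begin
           A (underlying F) (t * t)                        ≈⟨ charPoly-F (t * t) ⟩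
           det R (L (t * t) 1#)                            ≈⟨ det-L (t * t) 1# ⟩
           (t * t) ^ d * ((t * t) ^ k - 1# ^ k)           ≈⟨ *-cong (pow-square t d) (+-cong (pow-square t k) (-‿cong (pow-1 k))) ⟩
           t ^ (2 ℕ.* d) * (t ^ (2 ℕ.* k) - 1#)           ∎)

    a2 : ∀ t → (A (F0++ F) t ≈ A (F+0+ F) t)
             × (A (F+0+ F) t ≈ (t ^ (2 ℕ.* d)) * ((t ^ (2 ℕ.* k)) - ((t + 1#) ^ k)))
    a2 t = trans (charPoly-derived false true t) (trans (det-cong (X-F0++ t)) (sym (charPoly-F+0+ t)))
         , (begin
           A (F+0+ F) t                                    ≈⟨ charPoly-F+0+ t ⟩
           det R (L (t * t) (t + 1#))                      ≈⟨ det-L (t * t) (t + 1#) ⟩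
           (t * t) ^ d * ((t * t) ^ k - (t + 1#) ^ k)     ≈⟨ *-cong (pow-square t d) (+-congʳ (pow-square t k)) ⟩
           t ^ (2 ℕ.* d) * (t ^ (2 ℕ.* k) - (t + 1#) ^ k) ∎)

    -- (a2), the middle expression (t+1)^N A(t²/(t+1), F), with u playing the
    -- role of 1/(t+1): (t+1)^e u^e = 1 absorbs the denominators
    a2-middle : ∀ t u → (t + 1#) * u ≈ 1# → A (F+0+ F) t ≈ ((t + 1#) ^ N) * A (underlying F) ((t * t) * u)
    a2-middle t u inverse = begin
      A (F+0+ F) t
        ≈⟨ charPoly-F+0+ t ⟩
      det R (L (t * t) (t + 1#))
        ≈⟨ det-L (t * t) (t + 1#) ⟩
      W d * (W k - V k)
        ≈⟨ solve 6 (λ vd ud wd vk uk wk → wd :* (wk :- vk) := (:1 :* wd) :* ((:1 :* wk) :- vk))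
                   refl (V d) (U d) (W d) (V k) (U k) (W k) ⟩
      (1# * W d) * ((1# * W k) - V k)
        ≈⟨ *-cong (*-congʳ (VU d)) (+-congʳ (*-congʳ (VU k))) ⟨
      ((V d * U d) * W d) * (((V k * U k) * W k) - V k)
        ≈⟨ solve 6 (λ vd ud wd vk uk wk → ((vd :* ud) :* wd) :* (((vk :* uk) :* wk) :- vk)
                                          := (vd :* vk) :* ((wd :* ud) :* ((wk :* uk) :- :1)))
                   refl (V d) (U d) (W d) (V k) (U k) (W k) ⟩
      (V d * V k) * ((W d * U d) * ((W k * U k) - 1#))
        ≈⟨ *-cong (trans (sym (pow-+ (t + 1#) d k)) (reflexive (≡.cong V (ℕP.m∸n+n≡m k≤N))))
                  (*-cong (sym (pow-* (t * t) u d)) (+-cong (sym (pow-* (t * t) u k)) (-‿cong (sym (pow-1 k))))) ⟩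
      V N * (((t * t) * u) ^ d * (((t * t) * u) ^ k - 1# ^ k))
        ≈⟨ *-congˡ (trans (charPoly-F ((t * t) * u)) (det-L ((t * t) * u) 1#)) ⟨
      V N * A (underlying F) ((t * t) * u) ∎
      where
      V W U : ℕ → Carrier
      V e = (t + 1#) ^ e
      W e = (t * t) ^ e
      U e = u ^ e
      k≤N : k ℕ.≤ N
      k≤N = FP.injective⇒≤ (Unicyclic.cyc-inj unicyclic)
      VU : ∀ e → V e * U e ≈ 1#
      VU e = trans (sym (pow-* (t + 1#) u e)) (trans (pow-cong e inverse) (pow-1 e))

    -- (a3): x₁ and x₂ are the two roots of x² − (2t+1) x + t²
    a3 : ∀ t x₁ x₂ → x₁ + x₂ ≈ (t + t) + 1# → x₁ * x₂ ≈ t * t →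
         (A (F+++ F) t ≈ A (underlying F) x₁ * A (underlying F) x₂)
       × (A (underlying F) x₁ * A (underlying F) x₂ ≈ (t ^ ((2 ℕ.* N) ℕ.∸ (2 ℕ.* k))) * (((x₁ ^ k) - 1#) * ((x₂ ^ k) - 1#)))
    a3 t x₁ x₂ sum≈ prod≈ = (begin
      A (F+++ F) t
        ≈⟨ charPoly-derived true true t ⟩
      det R (X true true t)
        ≈⟨ det-cong (X-F+++ t x₁ x₂ sum≈ prod≈) ⟩
      det R (λ a b → sum (λ l → L x₂ 1# a l * L x₁ 1# l b))
        ≈⟨ det-mul (L x₁ 1#) (L x₂ 1#) ⟩
      det R (L x₂ 1#) * det R (L x₁ 1#)
        ≈⟨ *-comm _ _ ⟩
      det R (L x₁ 1#) * det R (L x₂ 1#)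
        ≈⟨ *-cong (charPoly-F x₁) (charPoly-F x₂) ⟨
      A (underlying F) x₁ * A (underlying F) x₂ ∎)
      , (begin
      A (underlying F) x₁ * A (underlying F) x₂
        ≈⟨ *-cong (trans (charPoly-F x₁) (det-L x₁ 1#)) (trans (charPoly-F x₂) (det-L x₂ 1#)) ⟩
      x₁ ^ d * (x₁ ^ k - 1# ^ k) * (x₂ ^ d * (x₂ ^ k - 1# ^ k))
        ≈⟨ solve 5 (λ a b p q o → a :* (p :- o) :* (b :* (q :- o)) := (a :* b) :* ((p :- o) :* (q :- o)))
                   refl (x₁ ^ d) (x₂ ^ d) (x₁ ^ k) (x₂ ^ k) (1# ^ k) ⟩
      (x₁ ^ d * x₂ ^ d) * ((x₁ ^ k - 1# ^ k) * (x₂ ^ k - 1# ^ k))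
        ≈⟨ *-cong (sym (pow-* x₁ x₂ d)) (*-cong (+-congˡ (-‿cong (pow-1 k))) (+-congˡ (-‿cong (pow-1 k)))) ⟩
      (x₁ * x₂) ^ d * ((x₁ ^ k - 1#) * (x₂ ^ k - 1#))
        ≈⟨ *-congʳ (trans (pow-cong d prod≈) (pow-square t d)) ⟩
      t ^ (2 ℕ.* d) * ((x₁ ^ k - 1#) * (x₂ ^ k - 1#))
        ≡⟨ ≡.cong (λ e → t ^ e * ((x₁ ^ k - 1#) * (x₂ ^ k - 1#))) (ℕP.*-distribˡ-∸ 2 N k) ⟩
      t ^ ((2 ℕ.* N) ℕ.∸ (2 ℕ.* k)) * ((x₁ ^ k - 1#) * (x₂ ^ k - 1#)) ∎)

open import Data.Nat using (_∸_; _*_)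

theorem6p6 : ∀ {c ℓ} (R : CommutativeRing c ℓ) (F : ArcDigraph) (k : ℕ) →
    Connected F →
    (IsDigraphFunction F ⊎ IsInverseDigraphFunction F) →
    HasDirectedCycle F k →
    let open CommutativeRing R renaming (_*_ to _·_)
        A = charPoly R
        _^_ = pow R
        N = n F
    in
    -- (a1)
    (∀ t → (A (F00+ F) t ≈ A (underlying F) (t · t))
         × (A (underlying F) (t · t) ≈ (t ^ (2 * (N ∸ k))) · ((t ^ (2 * k)) - 1#)))
    -- (a2), polynomial parts
    × (∀ t → (A (F0++ F) t ≈ A (F+0+ F) t)
         × (A (F+0+ F) t ≈ (t ^ (2 * (N ∸ k))) · ((t ^ (2 * k)) - ((t + 1#) ^ k))))
    -- (a2), middle expression (λ+1)^n A(λ²/(λ+1), F), where u = 1/(λ+1)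
    × (∀ t u → (t + 1#) · u ≈ 1# →
         A (F+0+ F) t ≈ ((t + 1#) ^ N) · A (underlying F) ((t · t) · u))
    -- (a3), x₁ x₂ the two roots of x² − (2λ+1) x + λ²
    × (∀ t x₁ x₂ → x₁ + x₂ ≈ (t + t) + 1# → x₁ · x₂ ≈ t · t →
         (A (F+++ F) t ≈ A (underlying F) x₁ · A (underlying F) x₂)
         × (A (underlying F) x₁ · A (underlying F) x₂
              ≈ (t ^ ((2 * N) ∸ (2 * k))) · (((x₁ ^ k) - 1#) · ((x₂ ^ k) - 1#))))
theorem6p6 R F k connected function-or-inverse cycle = a1 , a2 , a2-middle , a3
  where
  open Spectra.Consequences R (Spectra.spectral R connected function-or-inverse cycle)
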